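{- For every integer $t\ge 1$ and every $n\in\mathbb{N}$, \[ \chi(H_{2t}(n)) \le 2^{t\lceil \log_2 n\rceil}. \] Moreover, if $n$ is a power of $2$ or one less than a power of $2$, then there is a proper coloring of $H_{2t}(n)$ with at most $2^{t\lceil \log_2 n\rceil}$ colors in which all color classes have the same size.
   Context: $H_{2t}(n)$ is the graph with vertex set $\{0,1\}^n$ in which $x,y$ are adjacent iff their Hamming distance $|\{i : x_i\ne y_i\}|$ is exactly $2t$. $\chi$ denotes the chromatic number. -}

module Defs where

open import Data.Nat using (ℕ; zero; suc; _+_; _*_; _^_; _≤_)
open import Data.Bool using (Bool; true; false; _xor_; if_then_else_)
open import Data.Vec using (Vec; []; _∷_)
open import Data.List using (List; []; _∷_; _++_; map; length; filter)
open import Data.Fin using (Fin; _≟_)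
open import Relation.Binary.PropositionalEquality using (_≡_; _≢_)

Word : ℕ → Set
Word n = Vec Bool n

hamming : ∀ {n} → Word n → Word n → ℕ
hamming [] [] = 0
hamming (a ∷ x) (b ∷ y) = (if a xor b then 1 else 0) + hamming x y

Adj : ∀ {n} → ℕ → Word n → Word n → Set
Adj d x y = hamming x y ≡ d

ProperColoring : ℕ → (n k : ℕ) → (Word n → Fin k) → Set
ProperColoring d n k c = ∀ (x y : Word n) → Adj d x y → c x ≢ c y

ChromaticAtMost : ℕ → ℕ → ℕ → Set
ChromaticAtMost d n k = Data.Product.Σ (Word n → Fin k) (ProperColoring d n k)
  where import Data.Product

allWords : (n : ℕ) → List (Word n)
allWords zero = [] ∷ []
allWords (suc n) = map (false ∷_) (allWords n) ++ map (true ∷_) (allWords n)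

classSize : ∀ {n k} → (Word n → Fin k) → Fin k → ℕ
classSize {n} c i = length (filter (λ x → c x ≟ i) (allWords n))

Equitable : ∀ {n k} → (Word n → Fin k) → Set
Equitable {n} {k} c = ∀ (i j : Fin k) → classSize c i ≡ classSize c j

PowOr2PowMinus1 : ℕ → Set
PowOr2PowMinus1 n = Data.Product.∃ (λ m → n ≡ 2 ^ m Data.Sum.⊎ n + 1 ≡ 2 ^ m)
  where import Data.Product; import Data.Sum

-- Colour a word x of length n by its odd BCH syndromes S₁(x), S₃(x), …, S_{2t−1}(x),
-- where S_j(x) = Σ_{xᵢ = 1} αᵢʲ for n distinct elements αᵢ of GF(2^k), k = ⌈log₂ n⌉;
-- written with k bits each, these are 2^{tk} colours.  The map is 𝔽₂-linear.  If x and y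
-- are at distance 2t, then x ⊕ y has weight 2t and vanishing odd syndromes; as
-- S_{2j} = S_j² in characteristic 2, all of S₁, …, S_{2t} vanish, which a Vandermonde
-- argument rules out for at most 2t distinct nonzero points.  Colouring by the image of
-- the linear map makes the colour classes the cosets of its kernel, so they all have
-- the same size, for every n.
--
-- GF(2^k) is 𝔽₂[X]/(g) for a prime factor g of X^(2^k) + X of degree k, found as a
-- factor not dividing ∏_{1≤e<k} (X^(2^e) + X).

module Submission where

open import Defs
open import Algebra.Bundles using (CommutativeRing)
open import Algebra.Structures using (IsCommutativeRing)
open import Data.Bool using (Bool)
open import Data.Nat using (ℕ; suc; _≤_; _<_)
open import Relation.Nullary using (¬_)
open import Data.Vec using (Vec)
open import Data.Sum using (_⊎_; inj₁; inj₂)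
open import Level using (_⊔_)

module Polynomial where

  open import Algebra.Bundles using (CommutativeRing; CommutativeSemigroup)
  open import Algebra.Structures using (IsCommutativeRing; IsCommutativeSemigroup)
  open import Data.Bool using (Bool; true; false; _xor_)
  open import Data.Bool.Properties using (xor-assoc; xor-comm; xor-same; xor-identityʳ)
  open import Data.List using (List; []; _∷_; _++_)
  open import Data.Nat using (ℕ; zero; suc)
  open import Data.Product using (_,_)
  open import Level using (0ℓ)
  open import Relation.Binary.PropositionalEquality
  open import Relation.Binary.Structures using (IsEquivalence)

  -- Coefficient lists over 𝔽₂, constant term first.  Trailing zeros make the
  -- representation non-unique, so polynomials are compared coefficientwise.
  Poly : Set
  Poly = List Bool

  infixl 6 _+_
  infixl 7 _*_
  infix 4 _≈_

  _+_ : Poly → Poly → Poly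
  [] + q = q
  (a ∷ p) + [] = a ∷ p
  (a ∷ p) + (b ∷ q) = (a xor b) ∷ (p + q)

  scale : Bool → Poly → Poly
  scale false p = []
  scale true p = p

  _*_ : Poly → Poly → Poly
  [] * q = []
  (a ∷ p) * q = scale a q + (false ∷ p * q)

  coeff : Poly → ℕ → Bool
  coeff [] _ = false
  coeff (a ∷ p) zero = a
  coeff (a ∷ p) (suc i) = coeff p i

  record _≈_ (p q : Poly) : Set where
    constructor coeffwise
    field coeff-≡ : ∀ i → coeff p i ≡ coeff q i
  open _≈_ public

  1P X : Poly
  1P = true ∷ []
  X = false ∷ true ∷ []

  ≈-refl : ∀ {p} → p ≈ p
  ≈-refl = coeffwise λ _ → refl

  ≈-reflexive : ∀ {p q} → p ≡ q → p ≈ q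
  ≈-reflexive refl = ≈-refl

  ≈-sym : ∀ {p q} → p ≈ q → q ≈ p
  ≈-sym e = coeffwise λ i → sym (coeff-≡ e i)

  ≈-trans : ∀ {p q r} → p ≈ q → q ≈ r → p ≈ r
  ≈-trans e f = coeffwise λ i → trans (coeff-≡ e i) (coeff-≡ f i)

  ≈-isEquivalence : IsEquivalence _≈_
  ≈-isEquivalence = record { refl = ≈-refl ; sym = ≈-sym ; trans = ≈-trans }

  ∷-cong : ∀ {a b p q} → a ≡ b → p ≈ q → a ∷ p ≈ b ∷ q
  ∷-cong e f = coeffwise λ { zero → e ; (suc i) → coeff-≡ f i }

  ∷-injectiveʳ : ∀ {a b p q} → a ∷ p ≈ b ∷ q → p ≈ q
  ∷-injectiveʳ e = coeffwise λ i → coeff-≡ e (suc i)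

  tail≈[] : ∀ {a p} → a ∷ p ≈ [] → p ≈ []
  tail≈[] e = coeffwise λ i → coeff-≡ e (suc i)

  false∷≈[] : ∀ {p} → p ≈ [] → false ∷ p ≈ []
  false∷≈[] e = coeffwise λ { zero → refl ; (suc i) → coeff-≡ e i }

  ++-false∷[] : ∀ p → p ++ false ∷ [] ≈ p
  ++-false∷[] [] = false∷≈[] ≈-refl
  ++-false∷[] (a ∷ p) = ∷-cong refl (++-false∷[] p)

  coeff-+ : ∀ p q i → coeff (p + q) i ≡ coeff p i xor coeff q i
  coeff-+ [] q i = refl
  coeff-+ (a ∷ p) [] zero = sym (xor-identityʳ a)
  coeff-+ (a ∷ p) [] (suc i) = sym (xor-identityʳ _)
  coeff-+ (a ∷ p) (b ∷ q) zero = refl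
  coeff-+ (a ∷ p) (b ∷ q) (suc i) = coeff-+ p q i

  +-cong : ∀ {p p′ q q′} → p ≈ p′ → q ≈ q′ → p + q ≈ p′ + q′
  +-cong {p} {p′} {q} {q′} e f = coeffwise λ i → begin
    coeff (p + q) i             ≡⟨ coeff-+ p q i ⟩
    coeff p i xor coeff q i     ≡⟨ cong₂ _xor_ (coeff-≡ e i) (coeff-≡ f i) ⟩
    coeff p′ i xor coeff q′ i   ≡⟨ coeff-+ p′ q′ i ⟨
    coeff (p′ + q′) i           ∎
    where
    open ≡-Reasoning

  +-comm : ∀ p q → p + q ≈ q + p
  +-comm p q = coeffwise λ i → begin
    coeff (p + q) i           ≡⟨ coeff-+ p q i ⟩
    coeff p i xor coeff q i   ≡⟨ xor-comm (coeff p i) (coeff q i) ⟩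
    coeff q i xor coeff p i   ≡⟨ coeff-+ q p i ⟨
    coeff (q + p) i           ∎
    where
    open ≡-Reasoning

  +-assoc : ∀ p q r → (p + q) + r ≈ p + (q + r)
  +-assoc p q r = coeffwise λ i → begin
    coeff ((p + q) + r) i                          ≡⟨ coeff-+ (p + q) r i ⟩
    coeff (p + q) i xor coeff r i                  ≡⟨ cong (_xor coeff r i) (coeff-+ p q i) ⟩
    (coeff p i xor coeff q i) xor coeff r i        ≡⟨ xor-assoc (coeff p i) (coeff q i) (coeff r i) ⟩
    coeff p i xor (coeff q i xor coeff r i)        ≡⟨ cong (coeff p i xor_) (coeff-+ q r i) ⟨
    coeff p i xor coeff (q + r) i                  ≡⟨ coeff-+ p (q + r) i ⟨
    coeff (p + (q + r)) i                          ∎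
    where
    open ≡-Reasoning

  +-identityʳ : ∀ p → p + [] ≈ p
  +-identityʳ p = coeffwise λ i → trans (coeff-+ p [] i) (xor-identityʳ _)

  +-self : ∀ p → p + p ≈ []
  +-self p = coeffwise λ i → trans (coeff-+ p p i) (xor-same (coeff p i))

  +-isCommutativeSemigroup : IsCommutativeSemigroup _≈_ _+_
  +-isCommutativeSemigroup = record
    { isSemigroup = record
      { isMagma = record { isEquivalence = ≈-isEquivalence ; ∙-cong = +-cong }
      ; assoc = +-assoc }
    ; comm = +-comm }

  +-commutativeSemigroup : CommutativeSemigroup 0ℓ 0ℓ
  +-commutativeSemigroup = record { isCommutativeSemigroup = +-isCommutativeSemigroup }

  open import Algebra.Properties.CommutativeSemigroup +-commutativeSemigroup
    public using (interchange; x∙yz≈y∙xz)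

  scale-cong : ∀ a {p q} → p ≈ q → scale a p ≈ scale a q
  scale-cong false e = ≈-refl
  scale-cong true e = e

  scale-xor : ∀ a b p → scale (a xor b) p ≈ scale a p + scale b p
  scale-xor false b p = ≈-refl
  scale-xor true false p = ≈-sym (+-identityʳ p)
  scale-xor true true p = ≈-sym (+-self p)

  scale-+ : ∀ a p q → scale a (p + q) ≈ scale a p + scale a q
  scale-+ false p q = ≈-refl
  scale-+ true p q = ≈-refl

  scale-* : ∀ a q r → scale a q * r ≈ scale a (q * r)
  scale-* false q r = ≈-refl
  scale-* true q r = ≈-refl

  scale-[] : ∀ a → scale a [] ≈ []
  scale-[] false = ≈-refl
  scale-[] true = ≈-refl

  *-zeroʳ : ∀ p → p * [] ≈ []
  *-zeroʳ [] = ≈-refl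
  *-zeroʳ (false ∷ p) = false∷≈[] (*-zeroʳ p)
  *-zeroʳ (true ∷ p) = false∷≈[] (*-zeroʳ p)

  *-congˡ-[] : ∀ {p} q → p ≈ [] → p * q ≈ []
  *-congˡ-[] {[]} q e = ≈-refl
  *-congˡ-[] {false ∷ p} q e = false∷≈[] (*-congˡ-[] q (tail≈[] e))
  *-congˡ-[] {true ∷ p} q e with () ← coeff-≡ e zero

  *-congˡ : ∀ {p p′} q → p ≈ p′ → p * q ≈ p′ * q
  *-congˡ {[]} q e = ≈-sym (*-congˡ-[] q (≈-sym e))
  *-congˡ {a ∷ p} {[]} q e = *-congˡ-[] q e
  *-congˡ {a ∷ p} {b ∷ p′} q e with refl ← coeff-≡ e zero =
    +-cong ≈-refl (∷-cong refl (*-congˡ q (∷-injectiveʳ e)))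

  *-congʳ : ∀ p {q q′} → q ≈ q′ → p * q ≈ p * q′
  *-congʳ [] e = ≈-refl
  *-congʳ (a ∷ p) e = +-cong (scale-cong a e) (∷-cong refl (*-congʳ p e))

  *-cong : ∀ {p p′ q q′} → p ≈ p′ → q ≈ q′ → p * q ≈ p′ * q′
  *-cong {p′ = p′} {q = q} e f = ≈-trans (*-congˡ q e) (*-congʳ p′ f)

  *-identityˡ : ∀ p → 1P * p ≈ p
  *-identityˡ p = ≈-trans (+-cong ≈-refl (false∷≈[] ≈-refl)) (+-identityʳ p)

  *-distribʳ : ∀ r p q → (p + q) * r ≈ p * r + q * r
  *-distribʳ r [] q = ≈-refl
  *-distribʳ r (a ∷ p) [] = ≈-sym (+-identityʳ _)
  *-distribʳ r (a ∷ p) (b ∷ q) =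
    ≈-trans (+-cong (scale-xor a b r) (∷-cong refl (*-distribʳ r p q)))
            (interchange (scale a r) (scale b r) (false ∷ p * r) (false ∷ q * r))

  *-distribˡ : ∀ r p q → r * (p + q) ≈ r * p + r * q
  *-distribˡ [] p q = ≈-refl
  *-distribˡ (a ∷ r) p q =
    ≈-trans (+-cong (scale-+ a p q) (∷-cong refl (*-distribˡ r p q)))
            (interchange (scale a p) (scale a q) (false ∷ r * p) (false ∷ r * q))

  *-assoc : ∀ p q r → (p * q) * r ≈ p * (q * r)
  *-assoc [] q r = ≈-refl
  *-assoc (a ∷ p) q r = ≈-trans (*-distribʳ r (scale a q) (false ∷ p * q))
    (+-cong (scale-* a q r) (∷-cong refl (*-assoc p q r)))

  *-∷ : ∀ q a p → q * (a ∷ p) ≈ scale a q + (false ∷ q * p)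
  *-∷ [] a p = ≈-sym (+-cong (scale-[] a) (false∷≈[] ≈-refl))
  *-∷ (c ∷ q) a p = ≈-trans (+-cong ≈-refl (∷-cong refl (*-∷ q a p))) (swap c a)
    where
    swap : ∀ c a → scale c (a ∷ p) + (false ∷ scale a q + (false ∷ q * p))
                 ≈ scale a (c ∷ q) + (false ∷ scale c p + (false ∷ q * p))
    swap false false = ≈-refl
    swap false true = ≈-refl
    swap true false = ≈-refl
    swap true true = ∷-cong refl (x∙yz≈y∙xz p q (false ∷ q * p))

  *-comm : ∀ p q → p * q ≈ q * p
  *-comm [] q = ≈-sym (*-zeroʳ q)
  *-comm (a ∷ p) q = ≈-trans (+-cong ≈-refl (∷-cong refl (*-comm p q))) (≈-sym (*-∷ q a p))

  isCommutativeRing : IsCommutativeRing _≈_ _+_ _*_ (λ p → p) [] 1P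
  isCommutativeRing = record
    { isRing = record
      { +-isAbelianGroup = record
        { isGroup = record
          { isMonoid = record
            { isSemigroup = IsCommutativeSemigroup.isSemigroup +-isCommutativeSemigroup
            ; identity = (λ p → ≈-refl) , +-identityʳ }
          ; inverse = +-self , +-self
          ; ⁻¹-cong = λ e → e }
        ; comm = +-comm }
      ; *-cong = *-cong
      ; *-assoc = *-assoc
      ; *-identity = *-identityˡ , (λ p → ≈-trans (*-comm p 1P) (*-identityˡ p))
      ; distrib = *-distribˡ , *-distribʳ }
    ; *-comm = *-comm }

  ring : CommutativeRing 0ℓ 0ℓ
  ring = record { isCommutativeRing = isCommutativeRing }

CharacteristicTwo : ∀ {c ℓ} → CommutativeRing c ℓ → Set (c ⊔ ℓ)
CharacteristicTwo R = ∀ x → x + x ≈ 0#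
  where
  open CommutativeRing R

NoZeroDivisors : ∀ {c ℓ} → CommutativeRing c ℓ → Set (c ⊔ ℓ)
NoZeroDivisors R = ∀ x y → x * y ≈ 0# → x ≈ 0# ⊎ y ≈ 0#
  where
  open CommutativeRing R

module CharTwo {c ℓ} (R : CommutativeRing c ℓ) (+-self : CharacteristicTwo R) where

  open CommutativeRing R
  open import Algebra.Solver.Ring.NaturalCoefficients.Default commutativeSemiring
    using (solve; _:+_; _:*_; _:=_)
  open import Relation.Binary.Reasoning.Setoid setoid

  drop-double : ∀ {x y} z → x ≈ y + (z + z) → x ≈ y
  drop-double {y = y} z e = trans e (trans (+-congˡ (+-self z)) (+-identityʳ y))

  +≈0⇒≈ : ∀ {x y} → x + y ≈ 0# → x ≈ y
  +≈0⇒≈ {x} {y} e = begin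
    x            ≈⟨ drop-double y (+-assoc x y y) ⟨
    (x + y) + y  ≈⟨ +-congʳ e ⟩
    0# + y       ≈⟨ +-identityˡ y ⟩
    y            ∎

  ≈+⇒+≈ : ∀ {x y z} → x ≈ y + z → x + y ≈ z
  ≈+⇒+≈ {x} {y} {z} e = drop-double y (trans (+-congʳ e)
    (solve 2 (λ y z → (y :+ z) :+ y := z :+ (y :+ y)) refl y z))

  +-move : ∀ {a b c d} → a + b ≈ c + d → a + c ≈ b + d
  +-move {a} {b} {c} {d} e = begin
    a + c              ≈⟨ drop-double b (solve 3 (λ a b c → ((a :+ b) :+ c) :+ b := (a :+ c) :+ (b :+ b)) refl a b c) ⟨
    ((a + b) + c) + b  ≈⟨ +-congʳ (+-congʳ e) ⟩
    ((c + d) + c) + b  ≈⟨ drop-double c (solve 3 (λ b c d → ((c :+ d) :+ c) :+ b := (b :+ d) :+ (c :+ c)) refl b c d) ⟩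
    b + d              ∎

  square-+ : ∀ x y → (x + y) * (x + y) ≈ x * x + y * y
  square-+ x y = drop-double (x * y)
    (solve 2 (λ x y → (x :+ y) :* (x :+ y) := (x :* x :+ y :* y) :+ (x :* y :+ x :* y)) refl x y)

  open import Algebra.Properties.Semiring.Exp semiring public using (_^_)
  open import Algebra.Properties.Semiring.Exp semiring using (^-homo-*)
  open import Data.Nat using (ℕ; zero; suc) renaming (_+_ to _+ℕ_; _^_ to _^ℕ_)
  import Data.Nat.Properties as ℕ
  open import Data.Nat.GeneralisedArithmetic using (fold)
  import Relation.Binary.PropositionalEquality as ≡

  -- Defined by fold rather than by recursion, so that the instances for 𝔽₂[X] and for
  -- its quotient ring unfold to the same term.
  square^ : ℕ → Carrier → Carrier
  square^ n x = fold x (λ y → y * y) n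

  square^-cong : ∀ n {x y} → x ≈ y → square^ n x ≈ square^ n y
  square^-cong zero e = e
  square^-cong (suc n) e = *-cong (square^-cong n e) (square^-cong n e)

  square^-0 : ∀ n → square^ n 0# ≈ 0#
  square^-0 zero = refl
  square^-0 (suc n) = trans (*-cong (square^-0 n) (square^-0 n)) (zeroˡ 0#)

  square^-square^ : ∀ i e x → square^ i (square^ e x) ≡.≡ square^ (i +ℕ e) x
  square^-square^ zero e x = ≡.refl
  square^-square^ (suc i) e x = ≡.cong (λ y → y * y) (square^-square^ i e x)

  ^2^≈square^ : ∀ k x → x ^ (2 ^ℕ k) ≈ square^ k x
  ^2^≈square^ zero x = *-identityʳ x
  ^2^≈square^ (suc k) x = begin
    x ^ (2 ^ℕ k +ℕ (2 ^ℕ k +ℕ 0))  ≡⟨ ≡.cong (λ m → x ^ (2 ^ℕ k +ℕ m)) (ℕ.+-identityʳ (2 ^ℕ k)) ⟩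
    x ^ (2 ^ℕ k +ℕ 2 ^ℕ k)         ≈⟨ ^-homo-* x (2 ^ℕ k) (2 ^ℕ k) ⟩
    x ^ (2 ^ℕ k) * x ^ (2 ^ℕ k)    ≈⟨ *-cong (^2^≈square^ k x) (^2^≈square^ k x) ⟩
    square^ (suc k) x              ∎

module BitVector where

  open import Data.Bool using (Bool; true; false; _xor_)
  open import Data.Bool.Properties using (xor-identityʳ)
  open import Data.Vec using (Vec; []; _∷_; replicate; zipWith; _++_)
  open import Relation.Binary.PropositionalEquality

  infixl 6 _⊕_

  _⊕_ : ∀ {d} → Vec Bool d → Vec Bool d → Vec Bool d
  _⊕_ = zipWith _xor_

  ⊕-self : ∀ {d} (u : Vec Bool d) → u ⊕ u ≡ replicate d false
  ⊕-self [] = refl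
  ⊕-self (false ∷ u) = cong (false ∷_) (⊕-self u)
  ⊕-self (true ∷ u) = cong (false ∷_) (⊕-self u)

  ⊕≡0⇒≡ : ∀ {d} (u w : Vec Bool d) → u ⊕ w ≡ replicate d false → u ≡ w
  ⊕≡0⇒≡ [] [] e = refl
  ⊕≡0⇒≡ (false ∷ u) (false ∷ w) e = cong (false ∷_) (⊕≡0⇒≡ u w (cong Data.Vec.tail e))
  ⊕≡0⇒≡ (true ∷ u) (true ∷ w) e = cong (true ∷_) (⊕≡0⇒≡ u w (cong Data.Vec.tail e))
  ⊕≡0⇒≡ (false ∷ u) (true ∷ w) ()
  ⊕≡0⇒≡ (true ∷ u) (false ∷ w) ()

  ⊕-cancelˡ : ∀ {d} (r v : Vec Bool d) → v ⊕ (r ⊕ v) ≡ r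
  ⊕-cancelˡ [] [] = refl
  ⊕-cancelˡ (a ∷ r) (false ∷ v) = cong₂ _∷_ (xor-identityʳ a) (⊕-cancelˡ r v)
  ⊕-cancelˡ (false ∷ r) (true ∷ v) = cong (false ∷_) (⊕-cancelˡ r v)
  ⊕-cancelˡ (true ∷ r) (true ∷ v) = cong (true ∷_) (⊕-cancelˡ r v)

  ++-⊕ : ∀ {a b} (u u′ : Vec Bool a) (w w′ : Vec Bool b) →
         (u ++ w) ⊕ (u′ ++ w′) ≡ (u ⊕ u′) ++ (w ⊕ w′)
  ++-⊕ [] [] w w′ = refl
  ++-⊕ (x ∷ u) (y ∷ u′) w w′ = cong ((x xor y) ∷_) (++-⊕ u u′ w w′)

module Division where

  open Polynomial
  open CharTwo ring +-self using (+-move)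
  open BitVector
  open import Algebra.Properties.Semiring.Divisibility (CommutativeRing.semiring ring) public
    using (_∣_; _,_; ∣ʳ-refl; ∣ʳ-trans; ∣ʳ-respʳ-≈; ∣ʳ-respˡ-≈; x∣ʳy⇒x∣ʳzy; x∣ʳyx; _∣0)
  open import Algebra.Properties.CommutativeSemigroup.Divisibility (CommutativeRing.*-commutativeSemigroup ring) public
    using (x∣xy)
  open import Algebra.Solver.Ring.NaturalCoefficients.Default (CommutativeRing.commutativeSemiring ring)
    using (solve; _:+_; _:*_; _:=_)
  open import Data.Bool using (Bool; true; false)
  open import Data.Bool.Properties using () renaming (_≟_ to _≟ᵇ_)
  open import Data.Empty using (⊥-elim)
  open import Data.List using ([]; _∷_; _++_)
  open import Data.Nat using (ℕ; zero; suc; _≤_; z≤n; s≤s; _≤?_) renaming (_+_ to _+ℕ_)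
  open import Data.Nat.Properties using (≤-trans; ≤-antisym; m≤n+m; ≰⇒>; +-cancelʳ-≡)
  open import Data.Product using (Σ; _×_; _,_; proj₁; proj₂)
  open import Data.Sum using (_⊎_; inj₁; inj₂)
  open import Data.Vec using (Vec; []; _∷_; replicate; toList)
  open import Data.Vec.Properties using (≡-dec)
  open import Relation.Nullary using (¬_; Dec; yes; no)
  open import Relation.Binary.PropositionalEquality using (_≡_; refl; sym; trans; cong; cong₂)

  ∣-+ : ∀ {a b c} → a ∣ b → a ∣ c → a ∣ b + c
  ∣-+ {a} (q , qa≈b) (r , ra≈c) = q + r , ≈-trans (*-distribʳ a q r) (+-cong qa≈b ra≈c)

  IsPrime : Poly → Set
  IsPrime g = ∀ a b → g ∣ a * b → g ∣ a ⊎ g ∣ b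

  fromBits : ∀ {d} → Vec Bool d → Poly
  fromBits = toList

  monicWith : ∀ {d} → Vec Bool d → Poly
  monicWith v = fromBits v ++ 1P

  Monic : ℕ → Poly → Set
  Monic d p = Σ (Vec Bool d) λ v → p ≈ monicWith v

  DegreeBelow : ℕ → Poly → Set
  DegreeBelow d p = ∀ i → d ≤ i → coeff p i ≡ false

  monicWith-monic : ∀ {d} (v : Vec Bool d) → Monic d (monicWith v)
  monicWith-monic v = v , ≈-refl

  monicWith-leading : ∀ {d} (v : Vec Bool d) → coeff (monicWith v) d ≡ true
  monicWith-leading [] = refl
  monicWith-leading (b ∷ v) = monicWith-leading v

  monicWith-degreeBelow : ∀ {d} (v : Vec Bool d) → DegreeBelow (suc d) (monicWith v)
  monicWith-degreeBelow [] (suc i) _ = refl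
  monicWith-degreeBelow (b ∷ v) (suc i) (s≤s le) = monicWith-degreeBelow v i le

  fromBits-degreeBelow : ∀ {d} (v : Vec Bool d) → DegreeBelow d (fromBits v)
  fromBits-degreeBelow [] i _ = refl
  fromBits-degreeBelow (b ∷ v) (suc i) (s≤s le) = fromBits-degreeBelow v i le

  degreeBelow-resp : ∀ {d p q} → p ≈ q → DegreeBelow d p → DegreeBelow d q
  degreeBelow-resp e s i le = trans (sym (coeff-≡ e i)) (s i le)

  degreeBelow-mono : ∀ {d e p} → d ≤ e → DegreeBelow d p → DegreeBelow e p
  degreeBelow-mono le s i le′ = s i (≤-trans le le′)

  degreeBelow-scale : ∀ {d q} b → DegreeBelow d q → DegreeBelow d (scale b q)
  degreeBelow-scale false s i le = refl
  degreeBelow-scale true s = s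

  monic-resp : ∀ {d p q} → p ≈ q → Monic d p → Monic d q
  monic-resp e (v , f) = v , ≈-trans (≈-sym e) f

  monic-leading : ∀ {d p} → Monic d p → coeff p d ≡ true
  monic-leading {d} (v , e) = trans (coeff-≡ e d) (monicWith-leading v)

  monic⇒degreeBelow : ∀ {d p} → Monic d p → DegreeBelow (suc d) p
  monic⇒degreeBelow (v , e) = degreeBelow-resp (≈-sym e) (monicWith-degreeBelow v)

  monic⇒≉0 : ∀ {d p} → Monic d p → ¬ p ≈ []
  monic⇒≉0 {d} m e with () ← trans (sym (monic-leading m)) (coeff-≡ e d)

  monic-degree-≤ : ∀ {d e p} → Monic d p → DegreeBelow (suc e) p → d ≤ e
  monic-degree-≤ {d} {e} m s with d ≤? e
  ... | yes le = le
  ... | no d≰e with () ← trans (sym (monic-leading m)) (s d (≰⇒> d≰e))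

  monic-degree-unique : ∀ {d e p} → Monic d p → Monic e p → d ≡ e
  monic-degree-unique m m′ =
    ≤-antisym (monic-degree-≤ m (monic⇒degreeBelow m′)) (monic-degree-≤ m′ (monic⇒degreeBelow m))

  ≈0⊎monic : ∀ p → p ≈ [] ⊎ Σ ℕ λ d → Monic d p
  ≈0⊎monic [] = inj₁ ≈-refl
  ≈0⊎monic (a ∷ p) with ≈0⊎monic p
  ... | inj₂ (d , v , e) = inj₂ (suc d , a ∷ v , ∷-cong refl e)
  ≈0⊎monic (true ∷ p)  | inj₁ e = inj₂ (0 , [] , ∷-cong refl e)
  ≈0⊎monic (false ∷ p) | inj₁ e = inj₁ (false∷≈[] e)

  truncate : ∀ d → Poly → Vec Bool d
  truncate zero p = []
  truncate (suc d) [] = false ∷ truncate d []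
  truncate (suc d) (a ∷ p) = a ∷ truncate d p

  degreeBelow⇒fromBits : ∀ d p → DegreeBelow d p → p ≈ fromBits (truncate d p)
  degreeBelow⇒fromBits zero p s = coeffwise λ i → s i z≤n
  degreeBelow⇒fromBits (suc d) [] s = ≈-sym (false∷≈[] (≈-sym (degreeBelow⇒fromBits d [] λ _ _ → refl)))
  degreeBelow⇒fromBits (suc d) (a ∷ p) s = ∷-cong refl (degreeBelow⇒fromBits d p λ i le → s (suc i) (s≤s le))

  fromBits-⊕ : ∀ {d} (u w : Vec Bool d) → fromBits (u ⊕ w) ≈ fromBits u + fromBits w
  fromBits-⊕ [] [] = ≈-refl
  fromBits-⊕ (a ∷ u) (b ∷ w) = ∷-cong refl (fromBits-⊕ u w)

  fromBits-0 : ∀ {d} → fromBits (replicate d false) ≈ []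
  fromBits-0 {zero} = ≈-refl
  fromBits-0 {suc d} = false∷≈[] fromBits-0

  fromBits≈0 : ∀ {d} (u : Vec Bool d) → fromBits u ≈ [] → u ≡ replicate d false
  fromBits≈0 [] e = refl
  fromBits≈0 (b ∷ u) e = cong₂ _∷_ (coeff-≡ e 0) (fromBits≈0 u (tail≈[] e))

  monicWith-+-fromBits : ∀ {d} (v u : Vec Bool d) → monicWith v + fromBits u ≈ monicWith (v ⊕ u)
  monicWith-+-fromBits [] [] = ≈-refl
  monicWith-+-fromBits (a ∷ v) (b ∷ u) = ∷-cong refl (monicWith-+-fromBits v u)

  +-monic : ∀ {d p q} → DegreeBelow d q → Monic d p → Monic d (q + p)
  +-monic {d} {q = q} s (v , e) = v ⊕ truncate d q ,
    ≈-trans (+-cong (degreeBelow⇒fromBits d q s) e)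
            (≈-trans (+-comm (fromBits (truncate d q)) (monicWith v)) (monicWith-+-fromBits v (truncate d q)))

  *-monic : ∀ {d e p q} → Monic d p → Monic e q → Monic (d +ℕ e) (p * q)
  *-monic {e = e} {q = q} (v , p≈v) mq = monic-resp (≈-sym (*-congˡ q p≈v)) (go v)
    where
    go : ∀ {d} (v : Vec Bool d) → Monic (d +ℕ e) (monicWith v * q)
    go [] = monic-resp (≈-sym (*-identityˡ q)) mq
    go {suc d} (b ∷ v) with w , e′ ← go v =
      +-monic (degreeBelow-mono {p = scale b q} (s≤s (m≤n+m e d)) (degreeBelow-scale {q = q} b (monic⇒degreeBelow mq)))
              (false ∷ w , ∷-cong refl e′)

  ∣-monic-degree : ∀ {d e a b} → Monic d a → Monic e b → a ∣ b → d ≤ e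
  ∣-monic-degree {d} ma mb (q , qa≈b) with ≈0⊎monic q
  ... | inj₁ q≈0 = ⊥-elim (monic⇒≉0 mb (≈-trans (≈-sym qa≈b) (*-congˡ-[] _ q≈0)))
  ... | inj₂ (k , mq) with refl ← monic-degree-unique (monic-resp qa≈b (*-monic mq ma)) mb = m≤n+m d k

  ∣-same-degree⇒≈ : ∀ {d a b} → Monic d a → Monic d b → a ∣ b → a ≈ b
  ∣-same-degree⇒≈ {d} {a} ma mb (q , qa≈b) with ≈0⊎monic q
  ... | inj₁ q≈0 = ⊥-elim (monic⇒≉0 mb (≈-trans (≈-sym qa≈b) (*-congˡ-[] _ q≈0)))
  ... | inj₂ (k , w , q≈w) with refl ← +-cancelʳ-≡ d k 0 (monic-degree-unique (monic-resp qa≈b (*-monic (w , q≈w) ma)) mb)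
                           with [] ← w = ≈-trans (≈-sym (*-identityˡ a)) (≈-trans (*-congˡ a (≈-sym q≈w)) qa≈b)

  ∣-degreeBelow⇒≈0 : ∀ {d g p} → Monic d g → DegreeBelow d p → g ∣ p → p ≈ []
  ∣-degreeBelow⇒≈0 {d} mg s (q , qg≈p) with ≈0⊎monic q
  ... | inj₁ q≈0 = ≈-trans (≈-sym qg≈p) (*-congˡ-[] _ q≈0)
  ... | inj₂ (k , mq) with () ← trans (sym (monic-leading (monic-resp qg≈p (*-monic mq mg)))) (s (k +ℕ d) (m≤n+m d k))

  module DivisionBy {d} (v : Vec Bool d) where

    g : Poly
    g = monicWith v

    -- X · r + a, split into its d low coefficients and the coefficient of X^d
    shiftIn : ∀ {e} → Bool → Vec Bool e → Vec Bool e × Bool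
    shiftIn a [] = [] , a
    shiftIn a (b ∷ r) = a ∷ proj₁ (shiftIn b r) , proj₂ (shiftIn b r)

    shiftIn-correct : ∀ {e} a (r : Vec Bool e) →
                      a ∷ fromBits r ≡ fromBits (proj₁ (shiftIn a r)) ++ proj₂ (shiftIn a r) ∷ []
    shiftIn-correct a [] = refl
    shiftIn-correct a (b ∷ r) = cong (a ∷_) (shiftIn-correct b r)

    reduce : Vec Bool d × Bool → Vec Bool d
    reduce (r , false) = r
    reduce (r , true) = r ⊕ v

    ++-reduce : ∀ r c → fromBits r ++ c ∷ [] ≈ scale c g + fromBits (reduce (r , c))
    ++-reduce r false = ++-false∷[] (fromBits r)
    ++-reduce r true =
      ≈-sym (≈-trans (monicWith-+-fromBits v (r ⊕ v)) (≈-reflexive (cong monicWith (⊕-cancelˡ r v))))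

    division-step : ∀ a r → a ∷ fromBits r ≈ scale (proj₂ (shiftIn a r)) g + fromBits (reduce (shiftIn a r))
    division-step a r = ≈-trans (≈-reflexive (shiftIn-correct a r)) (++-reduce _ _)

    remainder : Poly → Vec Bool d
    remainder [] = replicate d false
    remainder (a ∷ p) = reduce (shiftIn a (remainder p))

    quotient : Poly → Poly
    quotient [] = []
    quotient (a ∷ p) = proj₂ (shiftIn a (remainder p)) ∷ quotient p

    division : ∀ p → p ≈ quotient p * g + fromBits (remainder p)
    division [] = ≈-sym fromBits-0
    division (a ∷ p) =
      ≈-trans (∷-cong refl (division p))
     (≈-trans (+-cong (≈-refl {false ∷ quotient p * g}) (division-step a (remainder p)))
              (solve 3 (λ Q S F → Q :+ (S :+ F) := (S :+ Q) :+ F) ≈-refl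
                     (false ∷ quotient p * g) (scale c g) (fromBits (reduce (shiftIn a (remainder p))))))
      where
      c : Bool
      c = proj₂ (shiftIn a (remainder p))

    remainder-unique : ∀ {p} q₁ q₂ r₁ r₂ →
      p ≈ q₁ * g + fromBits r₁ → p ≈ q₂ * g + fromBits r₂ → r₁ ≡ r₂
    remainder-unique q₁ q₂ r₁ r₂ e f =
      ⊕≡0⇒≡ r₁ r₂ (fromBits≈0 _ (∣-degreeBelow⇒≈0 (monicWith-monic v) (fromBits-degreeBelow (r₁ ⊕ r₂)) g∣r₁⊕r₂))
      where
      g∣r₁⊕r₂ : g ∣ fromBits (r₁ ⊕ r₂)
      g∣r₁⊕r₂ = q₁ + q₂ , ≈-trans (*-distribʳ g q₁ q₂)
        (≈-trans (+-move {q₁ * g} {fromBits r₁} {q₂ * g} {fromBits r₂} (≈-trans (≈-sym e) f)) (≈-sym (fromBits-⊕ r₁ r₂)))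

    ∣⇒remainder≡0 : ∀ {p} → g ∣ p → remainder p ≡ replicate d false
    ∣⇒remainder≡0 {p} (q , qg≈p) = remainder-unique (quotient p) q _ _ (division p)
      (≈-trans (≈-sym qg≈p) (≈-sym (≈-trans (+-cong ≈-refl fromBits-0) (+-identityʳ _))))

    remainder≡0⇒∣ : ∀ {p} → remainder p ≡ replicate d false → g ∣ p
    remainder≡0⇒∣ {p} e = quotient p , ≈-sym (≈-trans (division p)
      (≈-trans (+-cong ≈-refl (≈-trans (≈-reflexive (cong fromBits e)) fromBits-0)) (+-identityʳ _)))

    divides? : ∀ p → Dec (g ∣ p)
    divides? p with ≡-dec _≟ᵇ_ (remainder p) (replicate d false)
    ... | yes e = yes (remainder≡0⇒∣ e)
    ... | no ne = no λ g∣p → ne (∣⇒remainder≡0 g∣p)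

    remainder-+ : ∀ p q → remainder (p + q) ≡ remainder p ⊕ remainder q
    remainder-+ p q = remainder-unique (quotient (p + q)) (quotient p + quotient q) _ _ (division (p + q))
      (≈-trans (+-cong (division p) (division q))
      (≈-trans (solve 5 (λ a b c d G → (a :* G :+ c) :+ (b :* G :+ d) := (a :+ b) :* G :+ (c :+ d))
                        ≈-refl (quotient p) (quotient q) (fromBits (remainder p)) (fromBits (remainder q)) g)
               (+-cong ≈-refl (≈-sym (fromBits-⊕ (remainder p) (remainder q))))))

module Words where

  open import Data.Bool using (true; false; _xor_)
  open import Data.List using (List; []; _∷_; _++_; map; length)
  open import Data.List.Properties using (length-++; length-map)
  open import Data.List.Membership.Propositional using (_∈_)
  open import Data.List.Membership.Propositional.Properties using (∈-++⁺ˡ; ∈-++⁺ʳ; ∈-map⁺)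
  open import Data.List.Relation.Unary.All as All using (All; [])
  import Data.List.Relation.Unary.All.Properties as All
  open import Data.List.Relation.Unary.AllPairs as AllPairs using (AllPairs; []; _∷_)
  import Data.List.Relation.Unary.AllPairs.Properties as AllPairs
  open import Data.List.Relation.Unary.Any as Any using (here)
  open import Data.Nat using (ℕ; zero; suc; _+_; _^_; _≤_; z≤n; s≤s)
  open import Data.Nat.Properties using (+-identityʳ; m≤n⇒m≤1+n)
  open import Data.Product using (Σ; _,_)
  open import Data.Vec using ([]; _∷_)
  open import Relation.Nullary using (Dec)
  open import Relation.Nullary.Decidable using (map′)
  open import Relation.Unary using (Decidable)
  open import Relation.Binary.PropositionalEquality
  open BitVector using (_⊕_)

  allWords-length : ∀ n → length (allWords n) ≡ 2 ^ n
  allWords-length zero = refl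
  allWords-length (suc n) = begin
    length (map (false ∷_) (allWords n) ++ map (true ∷_) (allWords n))
      ≡⟨ length-++ (map (false ∷_) (allWords n)) ⟩
    length (map (false ∷_) (allWords n)) + length (map (true ∷_) (allWords n))
      ≡⟨ cong₂ _+_ (length-map (false ∷_) (allWords n)) (length-map (true ∷_) (allWords n)) ⟩
    length (allWords n) + length (allWords n)
      ≡⟨ cong (λ m → m + m) (allWords-length n) ⟩
    2 ^ n + 2 ^ n
      ≡⟨ cong (2 ^ n +_) (+-identityʳ (2 ^ n)) ⟨
    2 ^ suc n ∎
    where
    open ≡-Reasoning

  allWords-complete : ∀ {n} (x : Word n) → x ∈ allWords n
  allWords-complete [] = here refl
  allWords-complete (false ∷ x) = ∈-++⁺ˡ (∈-map⁺ (false ∷_) (allWords-complete x))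
  allWords-complete {suc n} (true ∷ x) = ∈-++⁺ʳ (map (false ∷_) (allWords n)) (∈-map⁺ (true ∷_) (allWords-complete x))

  allWords-distinct : ∀ n → AllPairs _≢_ (allWords n)
  allWords-distinct zero = [] ∷ []
  allWords-distinct (suc n) = AllPairs.++⁺ (prefixed false) (prefixed true)
    (All.map⁺ (All.universal (λ x → All.map⁺ (All.universal (λ y ()) (allWords n))) (allWords n)))
    where
    prefixed : ∀ b → AllPairs _≢_ (map (b ∷_) (allWords n))
    prefixed b = AllPairs.map⁺ (AllPairs.map (λ x≢y e → x≢y (cong Data.Vec.tail e)) (allWords-distinct n))

  searchWords : ∀ {n} {P : Word n → Set} → Decidable P → Dec (Σ (Word n) P)
  searchWords P? = map′ Any.satisfied (λ (x , px) → Any.map (λ { refl → px }) (allWords-complete x))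
                        (Any.any? P? (allWords _))

  weight : ∀ {n} → Word n → ℕ
  weight [] = 0
  weight (false ∷ w) = weight w
  weight (true ∷ w) = suc (weight w)

  weight-⊕ : ∀ {n} (x y : Word n) → weight (x ⊕ y) ≡ hamming x y
  weight-⊕ [] [] = refl
  weight-⊕ (false ∷ x) (false ∷ y) = weight-⊕ x y
  weight-⊕ (false ∷ x) (true ∷ y) = cong suc (weight-⊕ x y)
  weight-⊕ (true ∷ x) (false ∷ y) = cong suc (weight-⊕ x y)
  weight-⊕ (true ∷ x) (true ∷ y) = weight-⊕ x y

  hamming-≤ : ∀ {n} (x y : Word n) → hamming x y ≤ n
  hamming-≤ [] [] = z≤n
  hamming-≤ (a ∷ x) (b ∷ y) with a xor b
  ... | true = s≤s (hamming-≤ x y)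
  ... | false = m≤n⇒m≤1+n (hamming-≤ x y)

module Arithmetic where

  open import Data.Nat using (ℕ; zero; suc; _+_; _^_; _≤_; _<_; z≤n; s≤s; ⌊_/2⌋; ⌈_/2⌉)
  open import Data.Nat.Induction using (<-wellFounded)
  open import Data.Nat.Logarithm using (⌈log₂_⌉)
  open import Data.Nat.Logarithm.Core using (⌈log2⌉)
  open import Data.Nat.Properties
    using (anyUpTo?; +-suc; +-mono-≤; +-monoˡ-≤; +-identityʳ; ⌊n/2⌋+⌈n/2⌉≡n; ⌊n/2⌋≤⌈n/2⌉; ⌈n/2⌉<n; module ≤-Reasoning)
  open import Data.Product using (Σ; _×_; _,_)
  open import Induction.WellFounded using (Acc; acc)
  open import Relation.Nullary using (¬_; yes; no)
  open import Relation.Unary using (Decidable)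
  open import Relation.Binary.PropositionalEquality using (subst; cong)

  data Parity : ℕ → Set where
    odd : ∀ i → Parity (suc (i + i))
    even : ∀ i → Parity (i + i)

  parity : ∀ j → Parity j
  parity zero = even 0
  parity (suc j) with parity j
  ... | odd i = subst Parity (cong suc (+-suc i i)) (even (suc i))
  ... | even i = odd i

  leastWitness : ∀ {P : ℕ → Set} → Decidable P → ∀ {n} → P n →
                 Σ ℕ λ m → P m × (∀ {k} → k < m → ¬ P k)
  leastWitness {P} P? {n} = go n (<-wellFounded n)
    where
    go : ∀ n → Acc _<_ n → P n → Σ ℕ λ m → P m × (∀ {k} → k < m → ¬ P k)
    go n (acc below) pn with anyUpTo? P? n
    ... | yes (k , k<n , pk) = go k (below k<n) pk
    ... | no none = n , pn , λ k<n pk → none (_ , k<n , pk)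

  ≤2^⌈log₂⌉ : ∀ n → n ≤ 2 ^ ⌈log₂ n ⌉
  ≤2^⌈log₂⌉ n = go n (<-wellFounded n)
    where
    go : ∀ n (a : Acc _<_ n) → n ≤ 2 ^ ⌈log2⌉ n a
    go zero _ = z≤n
    go (suc zero) _ = s≤s z≤n
    go (suc (suc n)) (acc below) = begin
      2 + n                        ≡⟨ cong (2 +_) (⌊n/2⌋+⌈n/2⌉≡n n) ⟨
      2 + (⌊ n /2⌋ + h)            ≤⟨ s≤s (s≤s (+-monoˡ-≤ h (⌊n/2⌋≤⌈n/2⌉ n))) ⟩
      2 + (h + h)                  ≡⟨ cong suc (+-suc h h) ⟨
      suc h + suc h                ≤⟨ +-mono-≤ IH IH ⟩
      2 ^ L + 2 ^ L                ≡⟨ cong (2 ^ L +_) (+-identityʳ (2 ^ L)) ⟨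
      2 ^ suc L                    ∎
      where
      open ≤-Reasoning
      h L : ℕ
      h = ⌈ n /2⌉
      L = ⌈log2⌉ (suc h) (below (⌈n/2⌉<n n))
      IH : suc h ≤ 2 ^ L
      IH = go (suc h) (below (⌈n/2⌉<n n))

module Divisors where

  open Polynomial
  open CharTwo ring +-self using (≈+⇒+≈; square^)
  open Division
  open Words using (searchWords)
  open Arithmetic using (leastWitness)
  open import Algebra.Solver.Ring.NaturalCoefficients.Default (CommutativeRing.commutativeSemiring ring)
    using (solve; _:+_; _:*_; _:=_)
  open import Data.Bool using (Bool; true; false)
  open import Data.Empty using (⊥-elim)
  open import Data.List using ([]; _∷_; length)
  open import Data.Nat using (ℕ; zero; suc; _≤_; _<_; _≤?_; z≤n; s≤s; _^_) renaming (_+_ to _+ℕ_)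
  open import Data.Nat.Properties using (≮⇒≥; ≤-antisym; m≤n⇒m<n∨m≡n; ^-monoʳ-≤)
  import Data.Nat.Properties as ℕ
  open import Data.Product using (Σ; _×_; _,_; proj₁; proj₂)
  open import Data.Sum using (_⊎_; inj₁; inj₂)
  open import Data.Vec using (Vec; []; _∷_)
  open import Relation.Nullary using (¬_)
  open import Relation.Nullary.Decidable using (_×-dec_)
  open import Relation.Binary.PropositionalEquality using (_≡_; refl; subst; cong; sym; module ≡-Reasoning)

  record Bezout (a b : Poly) : Set where
    field
      gcd s t : Poly
      gcd∣a : gcd ∣ a
      gcd∣b : gcd ∣ b
      identity : gcd ≈ s * a + t * b

  degreeBelow-length : ∀ p → DegreeBelow (length p) p
  degreeBelow-length [] i _ = refl
  degreeBelow-length (a ∷ p) (suc i) (s≤s le) = degreeBelow-length p i le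

  bezout : ∀ a b → Bezout a b
  bezout a b = euclid (length b) a b (degreeBelow-length b)
    where
    trivial : ∀ {a b} → b ≈ [] → Bezout a b
    trivial {a} {b} b≈0 = record
      { gcd = a ; s = 1P ; t = [] ; gcd∣a = ∣ʳ-refl ; gcd∣b = ∣ʳ-respʳ-≈ (≈-sym b≈0) (a ∣0)
      ; identity = ≈-sym (≈-trans (+-identityʳ _) (*-identityˡ a)) }

    euclid : ∀ n a b → DegreeBelow n b → Bezout a b
    euclid zero a b deg = trivial (coeffwise λ i → deg i z≤n)
    euclid (suc n) a b deg with ≈0⊎monic b
    ... | inj₁ b≈0 = trivial b≈0
    ... | inj₂ (_ , v , b≈m) = record
      { gcd = gcd ; s = t ; t = s + t * q
      ; gcd∣a = ∣ʳ-respʳ-≈ (≈-sym (division a)) (∣-+ (x∣ʳy⇒x∣ʳzy q gcd∣a) gcd∣b)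
      ; gcd∣b = ∣ʳ-respʳ-≈ (≈-sym b≈m) gcd∣a
      ; identity = ≈-trans identity
          (≈-trans (+-cong ≈-refl (*-congʳ t (≈-sym (≈+⇒+≈ {a} {q * m} {r} (division a)))))
          (≈-trans (solve 5 (λ s t a q m → s :* m :+ t :* (a :+ q :* m) := t :* a :+ (s :+ t :* q) :* m) ≈-refl s t a q m)
                   (+-cong ≈-refl (*-congʳ (s + t * q) (≈-sym b≈m)))))
      }
      where
      open DivisionBy v using (quotient; remainder; division) renaming (g to m)
      q r : Poly
      q = quotient a
      r = fromBits (remainder a)
      open Bezout (euclid n m r (degreeBelow-mono {p = r} (monic-degree-≤ (v , b≈m) deg) (fromBits-degreeBelow (remainder a))))

  derivative : Poly → Poly
  derivative [] = []
  derivative (a ∷ p) = p + (false ∷ derivative p)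

  derivative-≈0 : ∀ {p} → p ≈ [] → derivative p ≈ []
  derivative-≈0 {[]} e = ≈-refl
  derivative-≈0 {a ∷ p} e = +-cong (tail≈[] e) (false∷≈[] (derivative-≈0 (tail≈[] e)))

  derivative-cong : ∀ {p q} → p ≈ q → derivative p ≈ derivative q
  derivative-cong {[]} e = ≈-sym (derivative-≈0 (≈-sym e))
  derivative-cong {a ∷ p} {[]} e = derivative-≈0 e
  derivative-cong {a ∷ p} {b ∷ q} e =
    +-cong (∷-injectiveʳ e) (∷-cong refl (derivative-cong (∷-injectiveʳ e)))

  derivative-+ : ∀ p q → derivative (p + q) ≈ derivative p + derivative q
  derivative-+ [] q = ≈-refl
  derivative-+ (a ∷ p) [] = ≈-sym (+-identityʳ _)
  derivative-+ (a ∷ p) (b ∷ q) = ≈-trans (+-cong ≈-refl (∷-cong refl (derivative-+ p q)))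
    (interchange p q (false ∷ derivative p) (false ∷ derivative q))

  derivative-scale : ∀ b q → derivative (scale b q) ≈ scale b (derivative q)
  derivative-scale false q = ≈-refl
  derivative-scale true q = ≈-refl

  derivative-* : ∀ p q → derivative (p * q) ≈ derivative p * q + p * derivative q
  derivative-* [] q = ≈-refl
  derivative-* (a ∷ p) q =
    ≈-trans (derivative-+ (scale a q) (false ∷ p * q))
   (≈-trans (+-cong (derivative-scale a q) (+-cong ≈-refl (∷-cong refl (derivative-* p q))))
   (≈-trans (solve 4 (λ A B C E → A :+ (B :+ (C :+ E)) := (B :+ C) :+ (A :+ E)) ≈-refl
                     (scale a (derivative q)) (p * q) (false ∷ derivative p * q) (false ∷ p * derivative q))
            (+-cong (≈-sym (*-distribʳ q p (false ∷ derivative p))) ≈-refl)))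

  derivative-square : ∀ p → derivative (p * p) ≈ []
  derivative-square p = ≈-trans (derivative-* p p)
    (≈-trans (+-cong ≈-refl (*-comm p (derivative p))) (+-self (derivative p * p)))

  X^2^_+X : ℕ → Poly
  X^2^ k +X = square^ k X + X

  -- g² ∣ f implies g ∣ f′, and here f′ = 1.
  X^2^k+X-squarefree : ∀ k {m g} → X^2^ suc k +X ≈ m * (g * g) → g ∣ 1P
  X^2^k+X-squarefree k {m} {g} e = derivative m * g , ≈-sym (begin
    1P                                            ≈⟨ derivative-X^2^k+X ⟨
    derivative (X^2^ suc k +X)                    ≈⟨ derivative-cong e ⟩
    derivative (m * (g * g))                      ≈⟨ derivative-* m (g * g) ⟩
    derivative m * (g * g) + m * derivative (g * g) ≈⟨ +-cong ≈-refl (≈-trans (*-congʳ m (derivative-square g)) (*-zeroʳ m)) ⟩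
    derivative m * (g * g) + []                   ≈⟨ +-identityʳ _ ⟩
    derivative m * (g * g)                        ≈⟨ *-assoc (derivative m) g g ⟨
    derivative m * g * g                          ∎)
    where
    open import Relation.Binary.Reasoning.Setoid (CommutativeRing.setoid ring)
    derivative-X^2^k+X : derivative (X^2^ suc k +X) ≈ 1P
    derivative-X^2^k+X = ≈-trans (derivative-+ (square^ (suc k) X) X)
      (+-cong (derivative-square (square^ k X)) (coeffwise λ { zero → refl ; (suc zero) → refl ; (suc (suc i)) → refl }))

  module LeastDivisor (h : Poly) {H} (h-monic : Monic (suc H) h) where

    HasDivisorOfDegree : ℕ → Set
    HasDivisorOfDegree e = 1 ≤ e × Σ (Vec Bool e) λ v → monicWith v ∣ h

    least : Σ ℕ λ m → HasDivisorOfDegree m × (∀ {k} → k < m → ¬ HasDivisorOfDegree k)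
    least = leastWitness (λ e → (1 ≤? e) ×-dec searchWords (λ v → DivisionBy.divides? v h))
                         (s≤s z≤n , proj₁ h-monic , ∣ʳ-respʳ-≈ (≈-sym (proj₂ h-monic)) ∣ʳ-refl)

    d : ℕ
    d = proj₁ least

    1≤d : 1 ≤ d
    1≤d = proj₁ (proj₁ (proj₂ least))

    v : Vec Bool d
    v = proj₁ (proj₂ (proj₁ (proj₂ least)))

    g : Poly
    g = monicWith v

    g∣h : g ∣ h
    g∣h = proj₂ (proj₂ (proj₁ (proj₂ least)))

    minimal : ∀ {e G} → Monic e G → 1 ≤ e → G ∣ h → d ≤ e
    minimal (w , G≈w) 1≤e G∣h = ≮⇒≥ λ e<d →
      proj₂ (proj₂ least) e<d (1≤e , w , ∣ʳ-respˡ-≈ G≈w G∣h)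

    prime : IsPrime g
    prime a b g∣ab = by-degree (≈0⊎monic gcd)
      where
      open Bezout (bezout a g)
      by-degree : gcd ≈ [] ⊎ Σ ℕ (λ e → Monic e gcd) → g ∣ a ⊎ g ∣ b
      by-degree (inj₁ gcd≈0) with q , q*gcd≈g ← gcd∣b =
        ⊥-elim (monic⇒≉0 (monicWith-monic v) (≈-trans (≈-sym q*gcd≈g) (≈-trans (*-congʳ q gcd≈0) (*-zeroʳ q))))
      by-degree (inj₂ (zero , [] , gcd≈1)) = inj₂ (∣ʳ-respʳ-≈ (≈-sym b-expansion) (∣-+ (x∣ʳy⇒x∣ʳzy s g∣ab) (x∣ʳyx g (t * b))))
        where
        b-expansion : b ≈ s * (a * b) + t * b * g
        b-expansion = ≈-trans (≈-sym (*-identityˡ b)) (≈-trans (*-congˡ b (≈-sym gcd≈1)) (≈-trans (*-congˡ b identity)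
          (solve 5 (λ s a t g b → (s :* a :+ t :* g) :* b := s :* (a :* b) :+ t :* b :* g) ≈-refl s a t g b)))
      by-degree (inj₂ (suc e , gcd-monic)) = inj₁ (∣ʳ-respˡ-≈ gcd≈g gcd∣a)
        where
        d≡ : d ≡ suc e
        d≡ = ≤-antisym (minimal gcd-monic (s≤s z≤n) (∣ʳ-trans gcd∣b g∣h)) (∣-monic-degree gcd-monic (monicWith-monic v) gcd∣b)
        gcd≈g : gcd ≈ g
        gcd≈g = ∣-same-degree⇒≈ gcd-monic (subst (λ k → Monic k g) d≡ (monicWith-monic v)) gcd∣b

  ∏X^2^e+X : ℕ → Poly
  ∏X^2^e+X zero = 1P
  ∏X^2^e+X (suc k) = ∏X^2^e+X k * X^2^ suc k +X

  X^2^e+X∣∏ : ∀ {e k} → 1 ≤ e → e ≤ k → X^2^ e +X ∣ ∏X^2^e+X k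
  X^2^e+X∣∏ {k = zero} (s≤s _) ()
  X^2^e+X∣∏ {k = suc k} 1≤e e≤k with m≤n⇒m<n∨m≡n e≤k
  ... | inj₂ refl = x∣ʳyx (X^2^ suc k +X) (∏X^2^e+X k)
  ... | inj₁ (s≤s e≤k′) = ∣ʳ-trans (X^2^e+X∣∏ 1≤e e≤k′) (x∣xy _ _)

  square^-X-monic : ∀ e → Monic (2 ^ e) (square^ e X)
  square^-X-monic zero = false ∷ [] , ≈-refl
  square^-X-monic (suc e) = subst (λ m → Monic m (square^ (suc e) X)) (cong (2 ^ e +ℕ_) (sym (ℕ.+-identityʳ (2 ^ e))))
    (*-monic (square^-X-monic e) (square^-X-monic e))

  X^2^e+X-monic : ∀ e → 1 ≤ e → Monic (2 ^ e) (X^2^ e +X)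
  X^2^e+X-monic e 1≤e = monic-resp (+-comm X (square^ e X))
    (+-monic (degreeBelow-mono {p = X} (^-monoʳ-≤ 2 1≤e) X-degreeBelow) (square^-X-monic e))
    where
    X-degreeBelow : DegreeBelow 2 X
    X-degreeBelow (suc (suc i)) _ = refl
    X-degreeBelow (suc zero) (s≤s ())

  ∏X^2^e+X-monic : ∀ k → Σ ℕ λ D → Monic D (∏X^2^e+X k) × D +ℕ 2 ≡ 2 ^ suc k
  ∏X^2^e+X-monic zero = 0 , ([] , ≈-refl) , refl
  ∏X^2^e+X-monic (suc k) with D , D-monic , D+2≡ ← ∏X^2^e+X-monic k =
    D +ℕ T , *-monic D-monic (X^2^e+X-monic (suc k) (s≤s z≤n)) , (begin
      (D +ℕ T) +ℕ 2   ≡⟨ ℕ.+-assoc D T 2 ⟩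
      D +ℕ (T +ℕ 2)   ≡⟨ cong (D +ℕ_) (ℕ.+-comm T 2) ⟩
      D +ℕ (2 +ℕ T)   ≡⟨ ℕ.+-assoc D 2 T ⟨
      (D +ℕ 2) +ℕ T   ≡⟨ cong (_+ℕ T) D+2≡ ⟩
      T +ℕ T          ≡⟨ cong (T +ℕ_) (ℕ.+-identityʳ T) ⟨
      2 ^ suc (suc k) ∎)
    where
    T : ℕ
    T = 2 ^ suc k
    open ≡-Reasoning

module CharTwoDomain {c ℓ} (R : CommutativeRing c ℓ) (+-self : CharacteristicTwo R)
                     (no-zero-divisors : NoZeroDivisors R) where

  open CommutativeRing R
  open CharTwo R +-self public
  open import Algebra.Solver.Ring.NaturalCoefficients.Default commutativeSemiring
    using (solve; _:+_; _:*_; _:=_)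
  open import Relation.Binary.Reasoning.Setoid setoid
  open import Data.Empty using (⊥; ⊥-elim)
  open import Data.List using (List; []; _∷_; length; map; replicate)
  open import Data.List.Relation.Unary.All as All using (All; []; _∷_)
  open import Data.List.Relation.Unary.AllPairs using (AllPairs; []; _∷_)
  open import Data.Nat using (ℕ; zero; suc; _≤_; _<_; z≤n; s≤s)
  import Data.Nat as ℕ
  open import Data.Bool using (false; true)
  open import Data.Vec using (Vec; []; _∷_; toList)
  open BitVector using (_⊕_)
  open Words using (weight)
  open import Algebra.Properties.Semiring.Exp semiring using (^-homo-*)
  open import Algebra.Properties.CommutativeSemigroup +-commutativeSemigroup using (interchange; x∙yz≈y∙xz)
  open import Data.Nat.Properties
    using (m≤n⇒m≤1+n; ≰⇒>; <-irrefl; ≤-trans; +-mono-≤; m≤n+m; m≤m+n; ≤-pred)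
  open import Data.Nat.Induction using (<-wellFounded)
  open import Induction.WellFounded using (Acc; acc)
  open Arithmetic using (parity; odd; even)
  open import Data.Product using (_×_; _,_; proj₂)
  open import Relation.Nullary using (¬_; Dec; yes; no)
  import Relation.Binary.PropositionalEquality as ≡

  Distinct : List Carrier → Set _
  Distinct = AllPairs λ x y → ¬ x ≈ y

  horner : List Carrier → Carrier → Carrier → Carrier
  horner [] l s = l
  horner (c ∷ cs) l s = c + s * horner cs l s

  horner-cong : ∀ cs l {s s′} → s ≈ s′ → horner cs l s ≈ horner cs l s′
  horner-cong [] l e = refl
  horner-cong (c ∷ cs) l e = +-congˡ (*-cong e (horner-cong cs l e))

  horner-replicate-0 : ∀ m l s → horner (replicate m 0#) l s ≈ s ^ m * l
  horner-replicate-0 zero l s = sym (*-identityˡ l)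
  horner-replicate-0 (suc m) l s =
    trans (+-identityˡ _) (trans (*-congˡ (horner-replicate-0 m l s)) (sym (*-assoc s (s ^ m) l)))

  -- coefficients of the quotient by X − r
  deflate : Carrier → List Carrier → Carrier → List Carrier
  deflate r [] l = []
  deflate r (c ∷ cs) l = horner (c ∷ cs) l r ∷ deflate r cs l

  length-deflate : ∀ r cs l → length (deflate r cs l) ≡.≡ length cs
  length-deflate r [] l = ≡.refl
  length-deflate r (c ∷ cs) l = ≡.cong suc (length-deflate r cs l)

  horner-deflate : ∀ c cs l r s →
    horner (c ∷ cs) l s ≈ horner (c ∷ cs) l r + (s + r) * horner (deflate r cs l) l s
  horner-deflate c [] l r s = sym (drop-double (r * l)
    (solve 4 (λ c l r s → (c :+ r :* l) :+ (s :+ r) :* l := (c :+ s :* l) :+ (r :* l :+ r :* l)) refl c l r s))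
  horner-deflate c (c′ ∷ cs) l r s = trans (+-congˡ (*-congˡ (horner-deflate c′ cs l r s)))
    (sym (drop-double (r * G) (solve 5 (λ c G Q r s →
       (c :+ r :* G) :+ (s :+ r) :* (G :+ s :* Q) := (c :+ s :* (G :+ (s :+ r) :* Q)) :+ (r :* G :+ r :* G))
       refl c G (horner (deflate r cs l) l s) r s)))
    where
    G : Carrier
    G = horner (c′ ∷ cs) l r

  roots-length-≤ : ∀ cs {l} → ¬ l ≈ 0# → ∀ rs → Distinct rs →
                   All (λ r → horner cs l r ≈ 0#) rs → length rs ≤ length cs
  roots-length-≤ cs l≉0 [] _ _ = z≤n
  roots-length-≤ [] l≉0 (r ∷ rs) _ (l≈0 ∷ _) = ⊥-elim (l≉0 l≈0)
  roots-length-≤ (c ∷ cs) {l} l≉0 (r ∷ rs) (r≉rs ∷ distinct) (root ∷ roots) =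
    s≤s (≡.subst (length rs ≤_) (length-deflate r cs l)
      (roots-length-≤ (deflate r cs l) l≉0 rs distinct (deflated-roots rs r≉rs roots)))
    where
    deflated-roots : ∀ rs → All (λ r′ → ¬ r ≈ r′) rs → All (λ r′ → horner (c ∷ cs) l r′ ≈ 0#) rs →
                     All (λ r′ → horner (deflate r cs l) l r′ ≈ 0#) rs
    deflated-roots [] _ _ = []
    deflated-roots (r′ ∷ rs) (r≉r′ ∷ r≉rs) (root′ ∷ roots)
      with no-zero-divisors (r′ + r) (horner (deflate r cs l) l r′) (begin
        (r′ + r) * horner (deflate r cs l) l r′                          ≈⟨ +-identityˡ _ ⟨
        0# + (r′ + r) * horner (deflate r cs l) l r′                     ≈⟨ +-congʳ root ⟨
        horner (c ∷ cs) l r + (r′ + r) * horner (deflate r cs l) l r′    ≈⟨ horner-deflate c cs l r r′ ⟨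
        horner (c ∷ cs) l r′                                             ≈⟨ root′ ⟩
        0#                                                               ∎)
    ... | inj₁ r′+r≈0 = ⊥-elim (r≉r′ (sym (+≈0⇒≈ r′+r≈0)))
    ... | inj₂ deflated-root = deflated-root ∷ deflated-roots rs r≉rs roots

  Term : Set c
  Term = Carrier × Carrier

  powerSum : List Term → ℕ → Carrier
  powerSum [] j = 0#
  powerSum ((c , b) ∷ L) j = c * b ^ j + powerSum L j

  bases : List Term → List Carrier
  bases = map proj₂

  NonzeroTerm : Term → Set ℓ
  NonzeroTerm (c , b) = ¬ c ≈ 0# × ¬ b ≈ 0#

  reweight : Carrier → List Term → List Term
  reweight β [] = []
  reweight β ((c , b) ∷ L) = (c * (b + β) , b) ∷ reweight β L

  powerSum-reweight : ∀ β L j → powerSum (reweight β L) j ≈ powerSum L (suc j) + β * powerSum L j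
  powerSum-reweight β [] j = sym (trans (+-congˡ (zeroʳ β)) (+-identityʳ 0#))
  powerSum-reweight β ((c , b) ∷ L) j = trans (+-congˡ (powerSum-reweight β L j))
    (solve 6 (λ c b β P A B → c :* (b :+ β) :* P :+ (A :+ β :* B) := (c :* (b :* P) :+ A) :+ β :* (c :* P :+ B))
           refl c b β (b ^ j) (powerSum L (suc j)) (powerSum L j))

  bases-reweight : ∀ β L → bases (reweight β L) ≡.≡ bases L
  bases-reweight β [] = ≡.refl
  bases-reweight β ((c , b) ∷ L) = ≡.cong (b ∷_) (bases-reweight β L)

  length-reweight : ∀ β L → length (reweight β L) ≡.≡ length L
  length-reweight β [] = ≡.refl
  length-reweight β (_ ∷ L) = ≡.cong suc (length-reweight β L)

  reweight-nonzero : ∀ β L → All (λ b → ¬ β ≈ b) (bases L) → All NonzeroTerm L → All NonzeroTerm (reweight β L)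
  reweight-nonzero β [] _ _ = []
  reweight-nonzero β ((c , b) ∷ L) (β≉b ∷ β≉L) ((c≉0 , b≉0) ∷ nonzero) =
    (c*[b+β]≉0 , b≉0) ∷ reweight-nonzero β L β≉L nonzero
    where
    c*[b+β]≉0 : ¬ c * (b + β) ≈ 0#
    c*[b+β]≉0 e with no-zero-divisors c (b + β) e
    ... | inj₁ c≈0 = c≉0 c≈0
    ... | inj₂ b+β≈0 = β≉b (sym (+≈0⇒≈ b+β≈0))

  -- Reweighting by the first base removes the first term and keeps the power sums
  -- p₁, …, p_{m−1} zero, so induction on the number of terms applies.
  powerSums-vanish⇒⊥ : ∀ m L → 1 ≤ length L → length L ≤ m → Distinct (bases L) → All NonzeroTerm L →
                       (∀ j → 1 ≤ j → j ≤ m → powerSum L j ≈ 0#) → ⊥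
  powerSums-vanish⇒⊥ m ((c , b) ∷ []) _ 1≤m _ ((c≉0 , b≉0) ∷ []) vanish
    with no-zero-divisors c (b * 1#) (trans (sym (+-identityʳ _)) (vanish 1 (s≤s z≤n) 1≤m))
  ... | inj₁ c≈0 = c≉0 c≈0
  ... | inj₂ b≈0 = b≉0 (trans (sym (*-identityʳ b)) b≈0)
  powerSums-vanish⇒⊥ (suc m) ((c , b) ∷ L@(_ ∷ _)) _ (s≤s |L|≤m) (b≉L ∷ L-distinct) (_ ∷ nonzero) vanish =
    powerSums-vanish⇒⊥ m (reweight b L)
      (≡.subst (1 ≤_) (≡.sym (length-reweight b L)) (s≤s z≤n))
      (≡.subst (_≤ m) (≡.sym (length-reweight b L)) |L|≤m)
      (≡.subst Distinct (≡.sym (bases-reweight b L)) L-distinct)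
      (reweight-nonzero b L b≉L nonzero)
      vanish′
    where
    vanish′ : ∀ j → 1 ≤ j → j ≤ m → powerSum (reweight b L) j ≈ 0#
    vanish′ j 1≤j j≤m = begin
      powerSum (reweight b L) j                               ≈⟨ +-identityˡ _ ⟨
      0# + powerSum (reweight b L) j                          ≈⟨ +-congʳ b-term≈0 ⟨
      powerSum (reweight b ((c , b) ∷ L)) j                   ≈⟨ powerSum-reweight b ((c , b) ∷ L) j ⟩
      powerSum ((c , b) ∷ L) (suc j) + b * powerSum ((c , b) ∷ L) j
        ≈⟨ +-cong (vanish (suc j) (s≤s z≤n) (s≤s j≤m)) (*-congˡ (vanish j 1≤j (m≤n⇒m≤1+n j≤m))) ⟩
      0# + b * 0#                                             ≈⟨ trans (+-identityˡ _) (zeroʳ b) ⟩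
      0#                                                      ∎
      where
      b-term≈0 : c * (b + b) * b ^ j ≈ 0#
      b-term≈0 = trans (*-congʳ (trans (*-congˡ (+-self b)) (zeroʳ c))) (zeroˡ _)

  square-injective : ∀ {x y} → x * x ≈ y * y → x ≈ y
  square-injective {x} {y} e with no-zero-divisors (x + y) (x + y) (trans (square-+ x y) (trans (+-congʳ e) (+-self _)))
  ... | inj₁ x+y≈0 = +≈0⇒≈ x+y≈0
  ... | inj₂ x+y≈0 = +≈0⇒≈ x+y≈0

  square^-injective : ∀ n {x y} → square^ n x ≈ square^ n y → x ≈ y
  square^-injective zero e = e
  square^-injective (suc n) e = square^-injective n (square-injective e)

  horner-square : ∀ cs l s → All (λ c → c * c ≈ c) cs → l * l ≈ l →
                  horner cs l (s * s) ≈ horner cs l s * horner cs l s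
  horner-square [] l s _ ll = sym ll
  horner-square (c ∷ cs) l s (cc ∷ ccs) ll = begin
    c + s * s * horner cs l (s * s)                        ≈⟨ +-cong (sym cc) (*-congˡ (horner-square cs l s ccs ll)) ⟩
    c * c + s * s * (horner cs l s * horner cs l s)        ≈⟨ +-congˡ (solve 2 (λ a b → (a :* a) :* (b :* b) := (a :* b) :* (a :* b)) refl s (horner cs l s)) ⟩
    c * c + s * horner cs l s * (s * horner cs l s)        ≈⟨ square-+ c (s * horner cs l s) ⟨
    horner (c ∷ cs) l s * horner (c ∷ cs) l s              ∎

  horner-square^ : ∀ n cs l s → All (λ c → c * c ≈ c) cs → l * l ≈ l →
                   horner cs l (square^ n s) ≈ square^ n (horner cs l s)
  horner-square^ zero cs l s _ _ = refl
  horner-square^ (suc n) cs l s ccs ll = trans (horner-square cs l (square^ n s) ccs ll)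
    (*-cong (horner-square^ n cs l s ccs ll) (horner-square^ n cs l s ccs ll))

  syndrome : ∀ {n} → Word n → Vec Carrier n → ℕ → Carrier
  syndrome [] [] j = 0#
  syndrome (false ∷ w) (a ∷ as) j = syndrome w as j
  syndrome (true ∷ w) (a ∷ as) j = a ^ j + syndrome w as j

  syndrome-⊕ : ∀ {n} (x y : Word n) as j → syndrome (x ⊕ y) as j ≈ syndrome x as j + syndrome y as j
  syndrome-⊕ [] [] [] j = sym (+-identityˡ 0#)
  syndrome-⊕ (false ∷ x) (false ∷ y) (a ∷ as) j = syndrome-⊕ x y as j
  syndrome-⊕ (false ∷ x) (true ∷ y) (a ∷ as) j = trans (+-congˡ (syndrome-⊕ x y as j))
    (x∙yz≈y∙xz (a ^ j) (syndrome x as j) (syndrome y as j))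
  syndrome-⊕ (true ∷ x) (false ∷ y) (a ∷ as) j = trans (+-congˡ (syndrome-⊕ x y as j))
    (sym (+-assoc (a ^ j) (syndrome x as j) (syndrome y as j)))
  syndrome-⊕ (true ∷ x) (true ∷ y) (a ∷ as) j = trans (syndrome-⊕ x y as j)
    (sym (trans (interchange (a ^ j) (syndrome x as j) (a ^ j) (syndrome y as j))
                (trans (+-congʳ (+-self (a ^ j))) (+-identityˡ _))))

  syndrome-square : ∀ {n} (w : Word n) as j → syndrome w as (j ℕ.+ j) ≈ syndrome w as j * syndrome w as j
  syndrome-square [] [] j = sym (zeroˡ 0#)
  syndrome-square (false ∷ w) (a ∷ as) j = syndrome-square w as j
  syndrome-square (true ∷ w) (a ∷ as) j =
    trans (+-cong (^-homo-* a j j) (syndrome-square w as j)) (sym (square-+ (a ^ j) (syndrome w as j)))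

  module _ (≈0? : ∀ x → Dec (x ≈ 0#)) (1≉0 : ¬ 1# ≈ 0#) where

    nonzeroTerms : ∀ {n} → Word n → Vec Carrier n → List Term
    nonzeroTerms [] [] = []
    nonzeroTerms (false ∷ w) (a ∷ as) = nonzeroTerms w as
    nonzeroTerms (true ∷ w) (a ∷ as) with ≈0? a
    ... | yes _ = nonzeroTerms w as
    ... | no _ = (1# , a) ∷ nonzeroTerms w as

    powerSum-nonzeroTerms : ∀ {n} (w : Word n) as j → powerSum (nonzeroTerms w as) (suc j) ≈ syndrome w as (suc j)
    powerSum-nonzeroTerms [] [] j = refl
    powerSum-nonzeroTerms (false ∷ w) (a ∷ as) j = powerSum-nonzeroTerms w as j
    powerSum-nonzeroTerms (true ∷ w) (a ∷ as) j with ≈0? a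
    ... | yes a≈0 = trans (powerSum-nonzeroTerms w as j)
                     (sym (trans (+-congʳ (trans (*-congʳ a≈0) (zeroˡ _))) (+-identityˡ _)))
    ... | no _ = +-cong (*-identityˡ _) (powerSum-nonzeroTerms w as j)

    length-nonzeroTerms-≤ : ∀ {n} (w : Word n) as → length (nonzeroTerms w as) ≤ weight w
    length-nonzeroTerms-≤ [] [] = z≤n
    length-nonzeroTerms-≤ (false ∷ w) (a ∷ as) = length-nonzeroTerms-≤ w as
    length-nonzeroTerms-≤ (true ∷ w) (a ∷ as) with ≈0? a
    ... | yes _ = m≤n⇒m≤1+n (length-nonzeroTerms-≤ w as)
    ... | no _ = s≤s (length-nonzeroTerms-≤ w as)

    weight-≤-length-nonzeroTerms : ∀ {n} (w : Word n) as → All (λ a → ¬ a ≈ 0#) (toList as) →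
                                   weight w ≤ length (nonzeroTerms w as)
    weight-≤-length-nonzeroTerms [] [] _ = z≤n
    weight-≤-length-nonzeroTerms (false ∷ w) (a ∷ as) (_ ∷ as≉0) = weight-≤-length-nonzeroTerms w as as≉0
    weight-≤-length-nonzeroTerms (true ∷ w) (a ∷ as) (a≉0 ∷ as≉0) with ≈0? a
    ... | yes a≈0 = ⊥-elim (a≉0 a≈0)
    ... | no _ = s≤s (weight-≤-length-nonzeroTerms w as as≉0)

    -- at most one of the distinct points is 0
    weight-≤-suc-length-nonzeroTerms : ∀ {n} (w : Word n) as → Distinct (toList as) →
                                       weight w ≤ suc (length (nonzeroTerms w as))
    weight-≤-suc-length-nonzeroTerms [] [] _ = z≤n
    weight-≤-suc-length-nonzeroTerms (false ∷ w) (a ∷ as) (_ ∷ distinct) = weight-≤-suc-length-nonzeroTerms w as distinct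
    weight-≤-suc-length-nonzeroTerms (true ∷ w) (a ∷ as) (a≉as ∷ distinct) with ≈0? a
    ... | yes a≈0 = s≤s (weight-≤-length-nonzeroTerms w as (All.map (λ a≉b b≈0 → a≉b (trans a≈0 (sym b≈0))) a≉as))
    ... | no _ = s≤s (weight-≤-suc-length-nonzeroTerms w as distinct)

    bases-nonzeroTerms-All : ∀ {p} {P : Carrier → Set p} {n} (w : Word n) as → All P (toList as) → All P (bases (nonzeroTerms w as))
    bases-nonzeroTerms-All [] [] _ = []
    bases-nonzeroTerms-All (false ∷ w) (a ∷ as) (_ ∷ ps) = bases-nonzeroTerms-All w as ps
    bases-nonzeroTerms-All (true ∷ w) (a ∷ as) (p ∷ ps) with ≈0? a
    ... | yes _ = bases-nonzeroTerms-All w as ps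
    ... | no _ = p ∷ bases-nonzeroTerms-All w as ps

    bases-nonzeroTerms-distinct : ∀ {n} (w : Word n) as → Distinct (toList as) → Distinct (bases (nonzeroTerms w as))
    bases-nonzeroTerms-distinct [] [] _ = []
    bases-nonzeroTerms-distinct (false ∷ w) (a ∷ as) (_ ∷ distinct) = bases-nonzeroTerms-distinct w as distinct
    bases-nonzeroTerms-distinct (true ∷ w) (a ∷ as) (a≉as ∷ distinct) with ≈0? a
    ... | yes _ = bases-nonzeroTerms-distinct w as distinct
    ... | no _ = bases-nonzeroTerms-All w as a≉as ∷ bases-nonzeroTerms-distinct w as distinct

    nonzeroTerms-nonzero : ∀ {n} (w : Word n) as → All NonzeroTerm (nonzeroTerms w as)
    nonzeroTerms-nonzero [] [] = []
    nonzeroTerms-nonzero (false ∷ w) (a ∷ as) = nonzeroTerms-nonzero w as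
    nonzeroTerms-nonzero (true ∷ w) (a ∷ as) with ≈0? a
    ... | yes _ = nonzeroTerms-nonzero w as
    ... | no a≉0 = (1≉0 , a≉0) ∷ nonzeroTerms-nonzero w as

    -- All syndromes S₁, …, S_{2t} vanish (S_{2i} = S_i²), and they are the power sums
    -- of the at most 2t nonzero points in the support.
    syndromes-vanish⇒⊥ : ∀ {n} t → 1 ≤ t → (w : Word n) (as : Vec Carrier n) → Distinct (toList as) →
                         weight w ≡.≡ t ℕ.+ t → (∀ i → i < t → syndrome w as (suc (i ℕ.+ i)) ≈ 0#) → ⊥
    syndromes-vanish⇒⊥ t 1≤t w as distinct weight≡ odd-vanish =
      powerSums-vanish⇒⊥ (t ℕ.+ t) (nonzeroTerms w as) nonempty length≤
        (bases-nonzeroTerms-distinct w as distinct) (nonzeroTerms-nonzero w as) vanish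
      where
      all-vanish : ∀ j → Acc _<_ j → 1 ≤ j → j ≤ t ℕ.+ t → syndrome w as j ≈ 0#
      all-vanish j (acc below) 1≤j j≤2t with parity j
      ... | odd i = odd-vanish i (≰⇒> λ t≤i → <-irrefl ≡.refl (≤-trans j≤2t (+-mono-≤ t≤i t≤i)))
      ... | even (suc i) = trans (syndrome-square w as (suc i)) (trans (*-cong IH IH) (zeroˡ 0#))
        where
        IH : syndrome w as (suc i) ≈ 0#
        IH = all-vanish (suc i) (below (s≤s (m≤n+m (suc i) i)))
                        (s≤s z≤n) (≤-trans (m≤m+n (suc i) (suc i)) j≤2t)
      vanish : ∀ j → 1 ≤ j → j ≤ t ℕ.+ t → powerSum (nonzeroTerms w as) j ≈ 0#
      vanish (suc j) _ j≤2t = trans (powerSum-nonzeroTerms w as j) (all-vanish (suc j) (<-wellFounded _) (s≤s z≤n) j≤2t)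
      length≤ : length (nonzeroTerms w as) ≤ t ℕ.+ t
      length≤ = ≡.subst (length (nonzeroTerms w as) ≤_) weight≡ (length-nonzeroTerms-≤ w as)
      nonempty : 1 ≤ length (nonzeroTerms w as)
      nonempty = ≤-pred (≤-trans (+-mono-≤ 1≤t 1≤t)
        (≡.subst (_≤ suc (length (nonzeroTerms w as))) weight≡ (weight-≤-suc-length-nonzeroTerms w as distinct)))

module Quotient {d} (v : Vec Bool d) (1≤d : 1 ≤ d) (prime : Division.IsPrime (Division.monicWith v)) where

  open Polynomial hiding (isCommutativeRing)
  open Division
  open CharTwo ring +-self using (drop-double)
  open BitVector using (_⊕_; ⊕≡0⇒≡)
  open import Relation.Binary.PropositionalEquality using (_≡_)
  open import Algebra.Solver.Ring.NaturalCoefficients.Default (CommutativeRing.commutativeSemiring ring)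
    using (solve; _:+_; _:*_; _:=_)
  open import Data.Nat.Properties using (<⇒≱)
  open import Data.Product using (_,_)
  open import Data.List using ([])
  open import Data.Vec using ([])
  open import Level using (0ℓ)
  open import Relation.Nullary using (¬_; Dec; yes; no)

  g : Poly
  g = monicWith v

  infix 4 _≈ₖ_
  record _≈ₖ_ (a b : Poly) : Set where
    constructor mod-g
    field g∣a+b : g ∣ a + b
  open _≈ₖ_ public

  ≈⇒≈ₖ : ∀ {a b} → a ≈ b → a ≈ₖ b
  ≈⇒≈ₖ {a} e = mod-g (∣ʳ-respʳ-≈ (≈-trans (≈-sym (+-self a)) (+-cong ≈-refl e)) (g ∣0))

  ≈ₖ-refl : ∀ {a} → a ≈ₖ a
  ≈ₖ-refl = ≈⇒≈ₖ ≈-refl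

  ≈ₖ-sym : ∀ {a b} → a ≈ₖ b → b ≈ₖ a
  ≈ₖ-sym {a} {b} (mod-g e) = mod-g (∣ʳ-respʳ-≈ (+-comm a b) e)

  ≈ₖ-trans : ∀ {a b c} → a ≈ₖ b → b ≈ₖ c → a ≈ₖ c
  ≈ₖ-trans {a} {b} {c} (mod-g e) (mod-g f) = mod-g (∣ʳ-respʳ-≈ (drop-double b
    (solve 3 (λ a b c → (a :+ b) :+ (b :+ c) := (a :+ c) :+ (b :+ b)) ≈-refl a b c)) (∣-+ e f))

  +-congₖ : ∀ {a a′ b b′} → a ≈ₖ a′ → b ≈ₖ b′ → a + b ≈ₖ a′ + b′
  +-congₖ {a} {a′} {b} {b′} (mod-g e) (mod-g f) = mod-g (∣ʳ-respʳ-≈ (interchange a a′ b b′) (∣-+ e f))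

  *-congₖ : ∀ {a a′ b b′} → a ≈ₖ a′ → b ≈ₖ b′ → a * b ≈ₖ a′ * b′
  *-congₖ {a} {a′} {b} {b′} (mod-g e) (mod-g f) = mod-g (∣ʳ-respʳ-≈ (drop-double (a * b′)
    (solve 4 (λ a a′ b b′ → a :* (b :+ b′) :+ (a :+ a′) :* b′ := (a :* b :+ a′ :* b′) :+ (a :* b′ :+ a :* b′))
           ≈-refl a a′ b b′))
    (∣-+ (x∣ʳy⇒x∣ʳzy a f) (∣ʳ-respʳ-≈ (*-comm b′ (a + a′)) (x∣ʳy⇒x∣ʳzy b′ e))))

  isCommutativeRing : IsCommutativeRing _≈ₖ_ _+_ _*_ (λ p → p) [] 1P
  isCommutativeRing = record
    { isRing = record
      { +-isAbelianGroup = record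
        { isGroup = record
          { isMonoid = record
            { isSemigroup = record
              { isMagma = record
                { isEquivalence = record { refl = ≈ₖ-refl ; sym = ≈ₖ-sym ; trans = ≈ₖ-trans }
                ; ∙-cong = +-congₖ }
              ; assoc = λ a b c → ≈⇒≈ₖ (+-assoc a b c) }
            ; identity = (λ a → ≈ₖ-refl) , (λ a → ≈⇒≈ₖ (+-identityʳ a)) }
          ; inverse = (λ a → ≈⇒≈ₖ (+-self a)) , (λ a → ≈⇒≈ₖ (+-self a))
          ; ⁻¹-cong = λ e → e }
        ; comm = λ a b → ≈⇒≈ₖ (+-comm a b) }
      ; *-cong = *-congₖ
      ; *-assoc = λ a b c → ≈⇒≈ₖ (*-assoc a b c)
      ; *-identity = (λ a → ≈⇒≈ₖ (*-identityˡ a)) , (λ a → ≈⇒≈ₖ (≈-trans (*-comm a 1P) (*-identityˡ a)))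
      ; distrib = (λ a b c → ≈⇒≈ₖ (*-distribˡ a b c)) , (λ a b c → ≈⇒≈ₖ (*-distribʳ a b c)) }
    ; *-comm = λ a b → ≈⇒≈ₖ (*-comm a b) }

  K : CommutativeRing 0ℓ 0ℓ
  K = record { isCommutativeRing = isCommutativeRing }

  +-selfₖ : CharacteristicTwo K
  +-selfₖ a = ≈⇒≈ₖ (+-self a)

  g∣⇒≈ₖ0 : ∀ {a} → g ∣ a → a ≈ₖ []
  g∣⇒≈ₖ0 {a} g∣a = mod-g (∣ʳ-respʳ-≈ (≈-sym (+-identityʳ a)) g∣a)

  ≈ₖ0⇒g∣ : ∀ {a} → a ≈ₖ [] → g ∣ a
  ≈ₖ0⇒g∣ {a} (mod-g e) = ∣ʳ-respʳ-≈ (+-identityʳ a) e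

  no-zero-divisors : NoZeroDivisors K
  no-zero-divisors a b ab≈0 with prime a b (≈ₖ0⇒g∣ ab≈0)
  ... | inj₁ g∣a = inj₁ (g∣⇒≈ₖ0 g∣a)
  ... | inj₂ g∣b = inj₂ (g∣⇒≈ₖ0 g∣b)

  ≈ₖ0? : ∀ a → Dec (a ≈ₖ [])
  ≈ₖ0? a with DivisionBy.divides? v (a + [])
  ... | yes g∣a = yes (mod-g g∣a)
  ... | no g∤a = no λ a≈0 → g∤a (g∣a+b a≈0)

  1≉ₖ0 : ¬ 1P ≈ₖ []
  1≉ₖ0 1≈0 = <⇒≱ 1≤d (∣-monic-degree (monicWith-monic v) ([] , ≈-refl) (≈ₖ0⇒g∣ 1≈0))

  fromBits-injectiveₖ : ∀ (u u′ : Vec Bool d) → fromBits u ≈ₖ fromBits u′ → u ≡ u′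
  fromBits-injectiveₖ u u′ (mod-g g∣u+u′) = ⊕≡0⇒≡ u u′ (fromBits≈0 (u ⊕ u′)
    (∣-degreeBelow⇒≈0 (monicWith-monic v) (fromBits-degreeBelow (u ⊕ u′))
                      (∣ʳ-respʳ-≈ (≈-sym (fromBits-⊕ u u′)) g∣u+u′)))

-- The Frobenius orbit X, X², …, X^(2^(k−1)) gives k distinct roots of g, and the 2^d
-- residues are roots of X^(2^k) + X; hence deg g = k.
module QuotientDegree {d} (v : Vec Bool d) (1≤d : 1 ≤ d) (prime : Division.IsPrime (Division.monicWith v))
  (k : ℕ) (1≤k : 1 ≤ k) (g∣X^2^k+X : Division._∣_ (Division.monicWith v) (Divisors.X^2^_+X k))
  (g∤X^2^e+X : ∀ {e} → 1 ≤ e → e < k → ¬ Division._∣_ (Division.monicWith v) (Divisors.X^2^_+X e)) where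

  open Polynomial hiding (isCommutativeRing)
  open Division
  open Divisors using (X^2^_+X)
  open Words using (allWords-length; allWords-distinct)
  open Quotient v 1≤d prime
  open CharTwoDomain K +-selfₖ no-zero-divisors
  open import Algebra.Solver.Ring.NaturalCoefficients.Default (CommutativeRing.commutativeSemiring K)
    using (solve; _:+_; _:*_; _:=_; con)
  open import Relation.Binary.Reasoning.Setoid (CommutativeRing.setoid K)
  open import Data.Bool using (true; false)
  open import Data.Bool.Properties using (xor-identityʳ)
  open import Data.List using (List; []; _∷_; length; map; applyUpTo; replicate; _++_)
  open import Data.List.Properties using (length-applyUpTo; length-map; length-replicate; ++-identityʳ)
  open import Data.List.Relation.Unary.All using (All; []; _∷_)
  import Data.List.Relation.Unary.All as All
  import Data.List.Relation.Unary.All.Properties as All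
  import Data.List.Relation.Unary.AllPairs as AllPairs
  import Data.List.Relation.Unary.AllPairs.Properties as AllPairs
  open import Data.Nat using (_∸_; _<_; s≤s; z≤n) renaming (_+_ to _+ℕ_; _^_ to _^ℕ_)
  open import Data.Nat.Properties
    using (≤-antisym; ≮⇒≥; <⇒≱; <⇒≤; ^-monoʳ-≤; ^-monoʳ-<; m+[n∸m]≡n; m∸n≤m; ≤-trans; m>n⇒m∸n≢0; n≢0⇒n>0)
  open import Data.Vec using ([]; _∷_)
  open import Relation.Nullary using (¬_)
  import Relation.Binary.PropositionalEquality as ≡

  constants : ∀ {e} → Vec Bool e → List Poly
  constants [] = []
  constants (b ∷ u) = (b ∷ []) ∷ constants u

  length-constants : ∀ {e} (u : Vec Bool e) → length (constants u) ≡.≡ e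
  length-constants [] = ≡.refl
  length-constants (b ∷ u) = ≡.cong suc (length-constants u)

  constants-idempotent : ∀ {e} (u : Vec Bool e) → All (λ c → c * c ≈ₖ c) (constants u)
  constants-idempotent [] = []
  constants-idempotent (false ∷ u) = ≈ₖ-refl ∷ constants-idempotent u
  constants-idempotent (true ∷ u) = ≈ₖ-refl ∷ constants-idempotent u

  horner-constants-X : ∀ {e} (u : Vec Bool e) l → horner (constants u) l X ≈ fromBits u ++ l
  horner-constants-X [] l = ≈-refl
  horner-constants-X (b ∷ u) l =
    ∷-cong (xor-identityʳ b) (≈-trans (*-identityˡ _) (horner-constants-X u l))

  orbit : List Poly
  orbit = applyUpTo (λ i → square^ i X) k

  ≡⇒≈ₖ : ∀ {a b} → a ≡.≡ b → a ≈ₖ b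
  ≡⇒≈ₖ ≡.refl = ≈ₖ-refl

  orbit-distinct : Distinct orbit
  orbit-distinct = AllPairs.applyUpTo⁺₁ _ k distinct
    where
    distinct : ∀ {i j} → i < j → j < k → ¬ square^ i X ≈ₖ square^ j X
    distinct {i} {j} i<j j<k e = g∤X^2^e+X (n≢0⇒n>0 (m>n⇒m∸n≢0 i<j)) (≤-trans (s≤s (m∸n≤m j i)) j<k)
      (∣ʳ-respʳ-≈ (+-comm X (square^ (j ∸ i) X)) (g∣a+b X≈X^2^[j∸i]))
      where
      X≈X^2^[j∸i] : X ≈ₖ square^ (j ∸ i) X
      X≈X^2^[j∸i] = square^-injective i (≈ₖ-trans e (≡⇒≈ₖ (≡.trans
        (≡.cong (λ m → square^ m X) (≡.sym (m+[n∸m]≡n (<⇒≤ i<j))))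
        (≡.sym (square^-square^ i (j ∸ i) X)))))

  horner-constants-X-g : horner (constants v) 1P X ≈ₖ []
  horner-constants-X-g = ≈ₖ-trans (≈⇒≈ₖ (horner-constants-X v 1P))
                                  (g∣⇒≈ₖ0 ∣ʳ-refl)

  orbit-roots : All (λ r → horner (constants v) 1P r ≈ₖ []) orbit
  orbit-roots = All.applyUpTo⁺₂ _ k λ i → begin
    horner (constants v) 1P (square^ i X)   ≈⟨ horner-square^ i (constants v) 1P X (constants-idempotent v) ≈ₖ-refl ⟩
    square^ i (horner (constants v) 1P X)   ≈⟨ square^-cong i horner-constants-X-g ⟩
    square^ i []                            ≈⟨ square^-0 i ⟩
    []                                      ∎

  k≤d : k ≤ d
  k≤d = ≡.subst₂ _≤_ (length-applyUpTo _ k) (length-constants v)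
    (roots-length-≤ (constants v) 1≉ₖ0 orbit orbit-distinct orbit-roots)

  fromBits-fixed : ∀ (u : Vec Bool d) → square^ k (fromBits u) ≈ₖ fromBits u
  fromBits-fixed u = begin
    square^ k (fromBits u)                     ≈⟨ square^-cong k (≈ₖ-sym fromBits≈horner) ⟩
    square^ k (horner (constants u) [] X)      ≈⟨ horner-square^ k (constants u) [] X (constants-idempotent u) ≈ₖ-refl ⟨
    horner (constants u) [] (square^ k X)      ≈⟨ horner-cong (constants u) [] X^2^k≈X ⟩
    horner (constants u) [] X                  ≈⟨ fromBits≈horner ⟩
    fromBits u                                 ∎
    where
    fromBits≈horner : horner (constants u) [] X ≈ₖ fromBits u
    fromBits≈horner = ≈⇒≈ₖ (≈-trans (horner-constants-X u []) (≈-reflexive (++-identityʳ (fromBits u))))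
    X^2^k≈X : square^ k X ≈ₖ X
    X^2^k≈X = mod-g g∣X^2^k+X

  2≤2^k : 2 ≤ 2 ^ℕ k
  2≤2^k = ^-monoʳ-≤ 2 1≤k

  X^2^k+X-coefficients : List Poly
  X^2^k+X-coefficients = [] ∷ 1P ∷ replicate (2 ^ℕ k ∸ 2) []

  horner-X^2^k+X : ∀ s → horner X^2^k+X-coefficients 1P s ≈ₖ s + square^ k s
  horner-X^2^k+X s = begin
    [] + s * (1P + s * H)      ≈⟨ solve 2 (λ s H → con 0 :+ s :* (con 1 :+ s :* H) := s :+ s :* (s :* H)) ≈ₖ-refl s H ⟩
    s + s * (s * H)            ≈⟨ +-congₖ (≈ₖ-refl {s}) (*-congₖ (≈ₖ-refl {s}) (*-congₖ (≈ₖ-refl {s}) H≈s^N)) ⟩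
    s + s ^ (2 +ℕ N)           ≡⟨ ≡.cong (λ m → s + s ^ m) (m+[n∸m]≡n 2≤2^k) ⟩
    s + s ^ (2 ^ℕ k)           ≈⟨ +-congₖ (≈ₖ-refl {s}) (^2^≈square^ k s) ⟩
    s + square^ k s            ∎
    where
    N : ℕ
    N = 2 ^ℕ k ∸ 2
    H : Poly
    H = horner (replicate N []) 1P s
    H≈s^N : H ≈ₖ s ^ N
    H≈s^N = ≈ₖ-trans (horner-replicate-0 N 1P s) (≈⇒≈ₖ (≈-trans (*-comm (s ^ N) 1P) (*-identityˡ (s ^ N))))

  residues : List Poly
  residues = map fromBits (allWords d)

  residues-distinct : Distinct residues
  residues-distinct = AllPairs.map⁺ (AllPairs.map (λ {u} {u′} u≢u′ e → u≢u′ (fromBits-injectiveₖ u u′ e)) (allWords-distinct d))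

  residues-roots : All (λ r → horner X^2^k+X-coefficients 1P r ≈ₖ []) residues
  residues-roots = All.map⁺ (All.universal (λ u → ≈ₖ-trans (horner-X^2^k+X (fromBits u))
    (≈ₖ-trans (+-congₖ ≈ₖ-refl (fromBits-fixed u)) (+-selfₖ (fromBits u)))) (allWords d))

  d≤k : d ≤ k
  d≤k = ≮⇒≥ λ k<d → <⇒≱ (^-monoʳ-< 2 (s≤s (s≤s z≤n)) k<d) 2^d≤2^k
    where
    2^d≤2^k : 2 ^ℕ d ≤ 2 ^ℕ k
    2^d≤2^k = ≡.subst₂ _≤_ (≡.trans (length-map fromBits (allWords d)) (allWords-length d))
      (≡.trans (≡.cong (2 +ℕ_) (length-replicate (2 ^ℕ k ∸ 2))) (m+[n∸m]≡n 2≤2^k))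
      (roots-length-≤ X^2^k+X-coefficients 1≉ₖ0 residues residues-distinct residues-roots)

  degree≡k : d ≡.≡ k
  degree≡k = ≤-antisym d≤k k≤d

module FiniteField where

  open Polynomial
  open Division
  open Divisors
  open import Algebra.Solver.Ring.NaturalCoefficients.Default (CommutativeRing.commutativeSemiring ring)
    using (solve; _:*_; _:=_)
  open import Data.Empty using (⊥-elim)
  open import Data.List using ([])
  open import Data.Nat using (zero; s≤s; z≤n; _^_) renaming (_+_ to _+ℕ_)
  open import Data.Nat.Properties using (<⇒≱; m<m+n; ≤-pred)
  open import Data.Product using (Σ; _,_)
  open import Data.Vec using ([])
  open import Relation.Binary.PropositionalEquality using (subst)

  record PrimeMonic (k : ℕ) : Set where
    field
      coefficients : Vec Bool k
      prime : IsPrime (monicWith coefficients)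

  -- A prime factor g of X^(2^k) + X that does not divide ∏_{1≤e<k} (X^(2^e) + X); it
  -- exists because X^(2^k) + X is squarefree and of larger degree than that product.
  primeMonic : ∀ k → 1 ≤ k → PrimeMonic k
  primeMonic (suc k) _ with D , ∏-monic , D+2≡ ← ∏X^2^e+X-monic k
                          | h , h*gcd≈Q ← Bezout.gcd∣a (bezout (X^2^ suc k +X) (∏X^2^e+X k))
                          = by-cofactor (≈0⊎monic h)
    where
    Q ∏ : Poly
    Q = X^2^ suc k +X
    ∏ = ∏X^2^e+X k
    open Bezout (bezout Q ∏)
    Q≈h*gcd : Q ≈ h * gcd
    Q≈h*gcd = ≈-sym h*gcd≈Q
    Q-monic : Monic (2 ^ suc k) Q
    Q-monic = X^2^e+X-monic (suc k) (s≤s z≤n)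
    Q∤∏ : ¬ Q ∣ ∏
    Q∤∏ Q∣∏ = <⇒≱ (subst (D <_) D+2≡ (m<m+n D (s≤s z≤n)))
                  (∣-monic-degree Q-monic ∏-monic Q∣∏)
    by-cofactor : h ≈ [] ⊎ Σ ℕ (λ e → Monic e h) → PrimeMonic (suc k)
    by-cofactor (inj₁ h≈0) = ⊥-elim (monic⇒≉0 Q-monic (≈-trans Q≈h*gcd (*-congˡ-[] gcd h≈0)))
    by-cofactor (inj₂ (zero , [] , h≈1)) =
      ⊥-elim (Q∤∏ (∣ʳ-respˡ-≈ (≈-sym (≈-trans Q≈h*gcd (≈-trans (*-congˡ gcd h≈1) (*-identityˡ gcd)))) gcd∣b))
    by-cofactor (inj₂ (suc H , h-monic)) = subst PrimeMonic (Degree.degree≡k) (record { coefficients = v ; prime = prime })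
      where
      open LeastDivisor h h-monic
      g∣Q : g ∣ Q
      g∣Q = ∣ʳ-trans g∣h (gcd , ≈-trans (*-comm gcd h) (≈-sym Q≈h*gcd))
      g∤∏ : ¬ g ∣ ∏
      g∤∏ g∣∏ with a , a*g≈h ← g∣h | b , b*g≈gcd ← ∣ʳ-respʳ-≈ (≈-sym identity) (∣-+ (x∣ʳy⇒x∣ʳzy s g∣Q) (x∣ʳy⇒x∣ʳzy t g∣∏)) =
        <⇒≱ 1≤d (∣-monic-degree (monicWith-monic v) (monicWith-monic []) (X^2^k+X-squarefree k {a * b} Q≈[ab]g²))
        where
        Q≈[ab]g² : Q ≈ (a * b) * (g * g)
        Q≈[ab]g² = ≈-trans Q≈h*gcd (≈-trans (*-cong (≈-sym a*g≈h) (≈-sym b*g≈gcd))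
          (solve 3 (λ a b g → (a :* g) :* (b :* g) := (a :* b) :* (g :* g)) ≈-refl a b g))
      g∤X^2^e+X : ∀ {e} → 1 ≤ e → e < suc k → ¬ g ∣ X^2^ e +X
      g∤X^2^e+X 1≤e e<k g∣X^2^e+X = g∤∏ (∣ʳ-trans g∣X^2^e+X (X^2^e+X∣∏ 1≤e (≤-pred e<k)))
      module Degree = QuotientDegree v 1≤d prime (suc k) (s≤s z≤n) g∣Q g∤X^2^e+X

module LinearColouring where

  open BitVector
  open Words using (allWords-complete)
  open import Data.Bool using (Bool; true; false)
  open import Data.Bool.Properties using () renaming (_≟_ to _≟ᵇ_)
  open import Data.Empty using (⊥-elim)
  open import Data.Fin using (Fin; zero; suc; combine; _≟_)
  open import Data.Fin.Properties using (combine-injectiveˡ; combine-injectiveʳ; injective⇒≤)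
  open import Data.List using (List; []; _∷_; _++_; map; length; filter; lookup; deduplicate)
  open import Data.List.Properties using (filter-++; length-++)
  open import Data.List.Membership.Propositional using (_∈_)
  open import Data.List.Membership.Propositional.Properties using (∈-map⁺; ∈-map⁻; ∈-lookup; ∈-deduplicate⁺; ∈-deduplicate⁻)
  import Data.List.Relation.Unary.All as All
  open import Data.List.Relation.Unary.AllPairs using (AllPairs; _∷_)
  open import Data.List.Relation.Unary.Any as Any using ()
  open import Data.List.Relation.Unary.Any.Properties using (lookup-index)
  open import Data.List.Relation.Unary.Unique.DecPropositional.Properties using (deduplicate-!)
  open import Data.Nat using (ℕ; zero; suc; _+_; _^_; _≤_)
  open import Data.Nat.Properties using (+-comm)
  open import Data.Product using (Σ; _×_; _,_)
  open import Data.Vec using (Vec; []; _∷_; replicate)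
  open import Data.Vec.Properties using (≡-dec)
  open import Relation.Nullary using (yes; no; does)
  open import Relation.Unary using (Decidable)
  open import Relation.Binary.PropositionalEquality

  bit : Bool → Fin 2
  bit false = zero
  bit true = suc zero

  bit-injective : ∀ a b → bit a ≡ bit b → a ≡ b
  bit-injective false false _ = refl
  bit-injective true true _ = refl

  toFin : ∀ {N} → Vec Bool N → Fin (2 ^ N)
  toFin [] = zero
  toFin (b ∷ u) = combine (bit b) (toFin u)

  toFin-injective : ∀ {N} (u w : Vec Bool N) → toFin u ≡ toFin w → u ≡ w
  toFin-injective [] [] _ = refl
  toFin-injective (a ∷ u) (b ∷ w) e =
    cong₂ _∷_ (bit-injective a b (combine-injectiveˡ (bit a) (toFin u) (bit b) (toFin w) e))
              (toFin-injective u w (combine-injectiveʳ (bit a) (toFin u) (bit b) (toFin w) e))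

  lookup-injective : ∀ {A : Set} {xs : List A} → AllPairs _≢_ xs → ∀ {i j} → lookup xs i ≡ lookup xs j → i ≡ j
  lookup-injective (_ ∷ _) {zero} {zero} _ = refl
  lookup-injective (x≢xs ∷ _) {zero} {suc j} e = ⊥-elim (All.lookup x≢xs (∈-lookup j) e)
  lookup-injective (x≢xs ∷ _) {suc i} {zero} e = ⊥-elim (All.lookup x≢xs (∈-lookup i) (sym e))
  lookup-injective (_ ∷ distinct) {suc i} {suc j} e = cong suc (lookup-injective distinct e)

  #words : ∀ {n} {P : Word n → Set} → Decidable P → ℕ
  #words P? = length (filter P? (allWords _))

  length-filter-map : ∀ {A B : Set} {P : B → Set} (P? : Decidable P) (f : A → B) xs →
                      length (filter P? (map f xs)) ≡ length (filter (λ x → P? (f x)) xs)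
  length-filter-map P? f [] = refl
  length-filter-map P? f (x ∷ xs) with does (P? (f x))
  ... | true = cong suc (length-filter-map P? f xs)
  ... | false = length-filter-map P? f xs

  length-filter-cong : ∀ {A : Set} {P Q : A → Set} (P? : Decidable P) (Q? : Decidable Q) →
                       (∀ {x} → P x → Q x) → (∀ {x} → Q x → P x) → ∀ xs →
                       length (filter P? xs) ≡ length (filter Q? xs)
  length-filter-cong P? Q? P⇒Q Q⇒P [] = refl
  length-filter-cong P? Q? P⇒Q Q⇒P (x ∷ xs) with P? x | Q? x
  ... | yes _ | yes _ = cong suc (length-filter-cong P? Q? P⇒Q Q⇒P xs)
  ... | no _ | no _ = length-filter-cong P? Q? P⇒Q Q⇒P xs
  ... | yes px | no ¬qx = ⊥-elim (¬qx (P⇒Q px))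
  ... | no ¬px | yes qx = ⊥-elim (¬px (Q⇒P qx))

  #words-suc : ∀ {n} {P : Word (suc n) → Set} (P? : Decidable P) →
               #words P? ≡ #words (λ x → P? (false ∷ x)) + #words (λ x → P? (true ∷ x))
  #words-suc {n} P? = begin
    length (filter P? (map (false ∷_) (allWords n) ++ map (true ∷_) (allWords n)))
      ≡⟨ cong length (filter-++ P? (map (false ∷_) (allWords n)) _) ⟩
    length (filter P? (map (false ∷_) (allWords n)) ++ filter P? (map (true ∷_) (allWords n)))
      ≡⟨ length-++ (filter P? (map (false ∷_) (allWords n))) ⟩
    length (filter P? (map (false ∷_) (allWords n))) + length (filter P? (map (true ∷_) (allWords n)))
      ≡⟨ cong₂ _+_ (length-filter-map P? (false ∷_) (allWords n)) (length-filter-map P? (true ∷_) (allWords n)) ⟩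
    #words (λ x → P? (false ∷ x)) + #words (λ x → P? (true ∷ x)) ∎
    where
    open ≡-Reasoning

  #words-translate : ∀ {n} {P : Word n → Set} (P? : Decidable P) (z : Word n) →
                     #words (λ x → P? (x ⊕ z)) ≡ #words P?
  #words-translate P? [] with does (P? [])
  ... | true = refl
  ... | false = refl
  #words-translate P? (false ∷ z) = trans (#words-suc (λ x → P? (x ⊕ (false ∷ z))))
    (trans (cong₂ _+_ (#words-translate (λ x → P? (false ∷ x)) z) (#words-translate (λ x → P? (true ∷ x)) z))
           (sym (#words-suc P?)))
  #words-translate P? (true ∷ z) = trans (#words-suc (λ x → P? (x ⊕ (true ∷ z))))
    (trans (cong₂ _+_ (#words-translate (λ x → P? (true ∷ x)) z) (#words-translate (λ x → P? (false ∷ x)) z))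
    (trans (+-comm (#words (λ x → P? (true ∷ x))) _) (sym (#words-suc P?))))

  -- The classes of `colour` are the cosets of the kernel of L, hence all of the same size.
  record SeparatingLinearMap (d n N : ℕ) : Set where
    field
      L : Word n → Vec Bool N
      L-⊕ : ∀ x y → L (x ⊕ y) ≡ L x ⊕ L y
      L-separates : ∀ x y → Adj d x y → L x ≢ L y

  module _ {d n N} (S : SeparatingLinearMap d n N) where

    open SeparatingLinearMap S

    colouring : ChromaticAtMost d n (2 ^ N)
    colouring = (λ x → toFin (L x)) , λ x y adj e → L-separates x y adj (toFin-injective (L x) (L y) e)

    image : List (Vec Bool N)
    image = deduplicate (≡-dec _≟ᵇ_) (map L (allWords n))

    ∈-image : ∀ x → L x ∈ image
    ∈-image x = ∈-deduplicate⁺ (≡-dec _≟ᵇ_) (∈-map⁺ L (allWords-complete x))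

    image-distinct : AllPairs _≢_ image
    image-distinct = deduplicate-! (≡-dec _≟ᵇ_) (map L (allWords n))

    colour : Word n → Fin (length image)
    colour x = Any.index (∈-image x)

    colour≡⇒ : ∀ {x i} → colour x ≡ i → L x ≡ lookup image i
    colour≡⇒ {x} refl = lookup-index (∈-image x)

    ⇒colour≡ : ∀ {x i} → L x ≡ lookup image i → colour x ≡ i
    ⇒colour≡ {x} e = lookup-injective image-distinct (trans (sym (colour≡⇒ refl)) e)

    classSize≡#kernel : ∀ i → classSize colour i ≡ #words (λ x → ≡-dec _≟ᵇ_ (L x) (replicate N false))
    classSize≡#kernel i with z , _ , image[i]≡Lz ← ∈-map⁻ L (∈-deduplicate⁻ (≡-dec _≟ᵇ_) (map L (allWords n)) (∈-lookup i)) =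
      trans (length-filter-cong (λ x → colour x ≟ i) (λ x → ≡-dec _≟ᵇ_ (L (x ⊕ z)) (replicate N false))
                                to from (allWords n))
            (#words-translate (λ x → ≡-dec _≟ᵇ_ (L x) (replicate N false)) z)
      where
      to : ∀ {x} → colour x ≡ i → L (x ⊕ z) ≡ replicate N false
      to {x} e = trans (L-⊕ x z) (trans (cong (_⊕ L z) (trans (colour≡⇒ e) image[i]≡Lz)) (⊕-self (L z)))
      from : ∀ {x} → L (x ⊕ z) ≡ replicate N false → colour x ≡ i
      from {x} e = ⇒colour≡ (trans (⊕≡0⇒≡ (L x) (L z) (trans (sym (L-⊕ x z)) e)) (sym image[i]≡Lz))

    equitableColouring : Σ ℕ λ m → m ≤ 2 ^ N × Σ (Word n → Fin m) λ c → ProperColoring d n m c × Equitable c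
    equitableColouring = length image
      , injective⇒≤ (λ e → lookup-injective image-distinct (toFin-injective _ _ e))
      , colour
      , (λ x y adj e → L-separates x y adj (trans (colour≡⇒ refl) (sym (colour≡⇒ (sym e)))))
      , λ i j → trans (classSize≡#kernel i) (sym (classSize≡#kernel j))

module BCH where

  open Polynomial using (Poly)
  open Division
  open BitVector
  open Words using (allWords-length; allWords-distinct; weight-⊕; hamming-≤)
  open LinearColouring using (SeparatingLinearMap)
  open FiniteField using (PrimeMonic; primeMonic)
  open import Data.Bool using (Bool)
  open import Data.List using (List; []; _∷_; map; length)
  open import Data.List.Properties using (length-map)
  open import Data.List.Relation.Unary.All using (All; []; _∷_)
  open import Data.List.Relation.Unary.AllPairs as AllPairs using (AllPairs; []; _∷_)
  import Data.List.Relation.Unary.AllPairs.Properties as AllPairs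
  open import Data.Nat using (zero; suc; s≤s; z≤n; _*_; _^_) renaming (_+_ to _+ℕ_)
  open import Data.Nat.Properties using (*-zeroʳ; +-identityʳ; <⇒≱; ≤-trans; *-monoʳ-≤; m≤n⇒m<n∨m≡n; ≤-pred)
  open import Data.Vec using (Vec; []; _∷_; toList; _++_)
  open import Data.Vec.Properties using (++-injectiveˡ; ++-injectiveʳ)
  open import Relation.Binary.PropositionalEquality

  prefix : ∀ {A : Set} n (xs : List A) → n ≤ length xs → Vec A n
  prefix zero xs _ = []
  prefix (suc n) (x ∷ xs) (s≤s n≤xs) = x ∷ prefix n xs n≤xs

  prefix-All : ∀ {A : Set} {P : A → Set} n xs n≤xs → All P xs → All P (toList (prefix n xs n≤xs))
  prefix-All zero xs _ _ = []
  prefix-All (suc n) (x ∷ xs) (s≤s n≤xs) (px ∷ pxs) = px ∷ prefix-All n xs n≤xs pxs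

  prefix-AllPairs : ∀ {A : Set} {R : A → A → Set} n xs n≤xs → AllPairs R xs → AllPairs R (toList (prefix n xs n≤xs))
  prefix-AllPairs zero xs _ _ = []
  prefix-AllPairs (suc n) (x ∷ xs) (s≤s n≤xs) (rx ∷ rxs) = prefix-All n xs n≤xs rx ∷ prefix-AllPairs n xs n≤xs rxs

  module Syndromes {n} (k : ℕ) (n≤2^k : n ≤ 2 ^ suc k) where

    open PrimeMonic (primeMonic (suc k) (s≤s z≤n)) renaming (coefficients to v)
    open Quotient v (s≤s z≤n) prime
    open CharTwoDomain K +-selfₖ no-zero-divisors
    open DivisionBy v using (remainder; remainder-+; ∣⇒remainder≡0; remainder≡0⇒∣)

    residues : List Poly
    residues = map fromBits (allWords (suc k))

    n≤|residues| : n ≤ length residues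
    n≤|residues| = subst (n ≤_) (sym (trans (length-map fromBits (allWords (suc k))) (allWords-length (suc k)))) n≤2^k

    points : Vec Poly n
    points = prefix n residues n≤|residues|

    points-distinct : Distinct (toList points)
    points-distinct = prefix-AllPairs n residues n≤|residues|
      (AllPairs.map⁺ (AllPairs.map (λ {u} {u′} u≢u′ e → u≢u′ (fromBits-injectiveₖ u u′ e)) (allWords-distinct (suc k))))

    encode-resp : ∀ {a b} → a ≈ₖ b → remainder a ≡ remainder b
    encode-resp {a} {b} (mod-g g∣a+b) = ⊕≡0⇒≡ (remainder a) (remainder b)
      (trans (sym (remainder-+ a b)) (∣⇒remainder≡0 g∣a+b))

    encode-injective : ∀ {a b} → remainder a ≡ remainder b → a ≈ₖ b
    encode-injective {a} {b} e = mod-g (remainder≡0⇒∣ (trans (remainder-+ a b)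
      (trans (cong (_⊕ remainder b) e) (⊕-self (remainder b)))))

    S : Word n → ℕ → Poly
    S x j = syndrome x points j

    syndromeBits : ∀ m → Word n → Vec Bool (m * suc k)
    syndromeBits zero x = []
    syndromeBits (suc m) x = remainder (S x (suc (m +ℕ m))) ++ syndromeBits m x

    syndromeBits-⊕ : ∀ m x y → syndromeBits m (x ⊕ y) ≡ syndromeBits m x ⊕ syndromeBits m y
    syndromeBits-⊕ zero x y = refl
    syndromeBits-⊕ (suc m) x y = trans
      (cong₂ _++_ (trans (encode-resp (syndrome-⊕ x y points j)) (remainder-+ (S x j) (S y j))) (syndromeBits-⊕ m x y))
      (sym (++-⊕ (remainder (S x j)) (remainder (S y j)) (syndromeBits m x) (syndromeBits m y)))
      where
      j : ℕ
      j = suc (m +ℕ m)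

    syndromeBits-≡ : ∀ m {x y} → syndromeBits m x ≡ syndromeBits m y → ∀ i → i < m → S x (suc (i +ℕ i)) ≈ₖ S y (suc (i +ℕ i))
    syndromeBits-≡ (suc m) {x} {y} e i i<m with m≤n⇒m<n∨m≡n (≤-pred i<m)
    ... | inj₂ refl = encode-injective (++-injectiveˡ (remainder (S x _)) (remainder (S y _)) e)
    ... | inj₁ i<m′ = syndromeBits-≡ m (++-injectiveʳ (remainder (S x _)) (remainder (S y _)) e) i i<m′

    separates : ∀ t → 1 ≤ t → ∀ x y → Adj (2 * t) x y → syndromeBits t x ≢ syndromeBits t y
    separates t 1≤t x y adj e = syndromes-vanish⇒⊥ ≈ₖ0? 1≉ₖ0 t 1≤t (x ⊕ y) points points-distinct
      (trans (weight-⊕ x y) (trans adj (cong (t +ℕ_) (+-identityʳ t))))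
      λ i i<t → ≈ₖ-trans (syndrome-⊕ x y points (suc (i +ℕ i)))
        (≈ₖ-trans (+-congₖ (syndromeBits-≡ t e i i<t) (≈ₖ-refl {S y (suc (i +ℕ i))})) (+-selfₖ (S y (suc (i +ℕ i)))))

  syndromeMap : ∀ t → 1 ≤ t → ∀ n k → n ≤ 2 ^ k → SeparatingLinearMap (2 * t) n (t * k)
  syndromeMap t 1≤t n zero n≤1 rewrite *-zeroʳ t = record
    { L = λ _ → []
    ; L-⊕ = λ _ _ → refl
    ; L-separates = λ x y adj _ → <⇒≱ (≤-trans (s≤s n≤1) (*-monoʳ-≤ 2 1≤t)) (subst (_≤ n) adj (hamming-≤ x y)) }
  syndromeMap t 1≤t n (suc k) n≤2^k = record
    { L = syndromeBits t ; L-⊕ = syndromeBits-⊕ t ; L-separates = separates t 1≤t }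
    where
    open Syndromes k n≤2^k

open import Data.Nat using (_*_; _^_)
open import Data.Nat.Logarithm using (⌈log₂_⌉)
open Arithmetic using (≤2^⌈log₂⌉)
open import Data.Fin using (Fin)
open import Data.Product using (Σ; _×_; _,_)

proposition5p1 : (t : ℕ) → 1 ≤ t → (n : ℕ)
    → ChromaticAtMost (2 * t) n (2 ^ (t * ⌈log₂ n ⌉))
    × (PowOr2PowMinus1 n
    → Σ ℕ (λ m → m ≤ 2 ^ (t * ⌈log₂ n ⌉)
    × Σ (Word n → Fin m) (λ c → ProperColoring (2 * t) n m c × Equitable c)))
-- The colouring by the image is equitable for every n.
proposition5p1 t 1≤t n = colouring syndromes , λ _ → equitableColouring syndromes
  where
  open LinearColouring using (SeparatingLinearMap; colouring; equitableColouring)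
  syndromes : SeparatingLinearMap (2 * t) n (t * ⌈log₂ n ⌉)
  syndromes = BCH.syndromeMap t 1≤t n ⌈log₂ n ⌉ (≤2^⌈log₂⌉ n)
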